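{- Let $q,k\in\mathbb{N}$ with $2\le q\le k/2$ and let $\Pi$ be a partition of $\mathbb{Z}_k$. Then the vector $x^\Pi$ satisfies \[ \sum_{i \in \mathbb{Z}_k} \left( x_{\{i,i+1\}} - x_{\{i,i+q\}} \right) \le k - \left\lceil \tfrac{k}{q} \right\rceil \] with equality if and only if one of the following two sets of conditions holds: (a) (a1) $|\Pi^{\mathrm{cyc}}| = \lceil k/q\rceil$; (a2) $|U|\le q$ for all $U\in\Pi^{\mathrm{cyc}}$; and (a3) for all $U\in\Pi$, all $U_1,U_2\in\Pi^{\mathrm{cyc}}$ with $U_1\ne U_2$ and $U_1,U_2\subseteq U$, and all $i\in U_1$, $j\in U_2$, it holds that $i-j>q$; (b) (b1) $|\Pi^{\mathrm{cyc}}| = \lceil k/q\rceil - 1$; and (b2) there exists $U\in\Pi^{\mathrm{cyc}}$ with $|U|=q+1$ and $|U'|=q$ for all $U'\in\Pi^{\mathrm{cyc}}\setminus\{U\}$.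
   Context: Nodes are identified with $\mathbb{Z}_k$ (integers mod $k$) and indices are taken modulo $k$. For a partition $\Pi$ of $\mathbb{Z}_k$, $x^\Pi\in\{0,1\}^{\binom{\mathbb{Z}_k}{2}}$ is defined by $x^\Pi_{\{i,j\}}=1$ iff $i$ and $j$ lie in a common block of $\Pi$. The cycle partition induced by $\Pi$, denoted $\Pi^{\mathrm{cyc}}$, is the set of node sets of the connected components of the graph $(\mathbb{Z}_k, E)$ with $E=\{\{i,i+1\} : i\in\mathbb{Z}_k,\ \exists U\in\Pi: i,i+1\in U\}$. In (a3), $i-j$ is understood as the cyclic distance along the cycle $0,1,\dots,k-1$, i.e. the blocks $U_1,U_2$ are separated by more than $q$ steps (at least $q$ nodes lie between them) in both directions around the cycle. -}

module Defs where

open import Data.Nat using (ℕ; zero; suc; _+_; _∸_; _/_; _≤_; _<_; _≡ᵇ_)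
open import Data.Nat.DivMod using (_mod_)
open import Data.Fin using (Fin; toℕ)
open import Data.Fin.Properties using () renaming (_≟_ to _≟ᶠ_)
open import Data.Bool using (Bool; true; false; _∨_; _∧_; if_then_else_)
open import Data.Integer as ℤ using (ℤ)
open import Data.List using (List; foldr; map; filter; length; allFin)
open import Relation.Nullary.Decidable using (⌊_⌋)
open import Relation.Binary.PropositionalEquality using (_≡_)
import Data.Product
import Data.Nat

-- A partition Π of ℤ_k (nodes = Fin k) is given by a block labelling:
-- the blocks of Π are the nonempty fibres of the labelling.
Partition : ℕ → Set
Partition k = Fin k → ℕ

sameBlock : ∀ {k} → Partition k → Fin k → Fin k → Bool
sameBlock Π i j = Π i ≡ᵇ Π j

x : ∀ {k} → Partition k → Fin k → Fin k → ℕ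
x Π i j = if sameBlock Π i j then 1 else 0

_⊕_ : ∀ {k} → Fin k → ℕ → Fin k
_⊕_ {suc n} i d = (toℕ i + d) mod suc n

_==_ : ∀ {k} → Fin k → Fin k → Bool
i == j = ⌊ i ≟ᶠ j ⌋

sumℕ : ∀ {k} → (Fin k → ℕ) → ℕ
sumℕ {k} f = foldr _+_ 0 (map f (allFin k))

sumℤ : ∀ {k} → (Fin k → ℤ) → ℤ
sumℤ {k} f = foldr ℤ._+_ (ℤ.+ 0) (map f (allFin k))

count : ∀ {k} → (Fin k → Bool) → ℕ
count {k} p = sumℕ (λ i → if p i then 1 else 0)

anyᶠ : ∀ {k} → (Fin k → Bool) → Bool
anyᶠ {k} p = foldr _∨_ false (map p (allFin k))

edge : ∀ {k} → Partition k → Fin k → Fin k → Bool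
edge Π i j = (j == (i ⊕ 1) ∨ i == (j ⊕ 1)) ∧ sameBlock Π i j

reach : ∀ {k} → Partition k → ℕ → Fin k → Fin k → Bool
reach Π zero    i j = i == j
reach Π (suc n) i j = reach Π n i j ∨ anyᶠ (λ m → reach Π n i m ∧ edge Π m j)

-- i and j lie in the same connected component of (ℤ_k, E), i.e. in the
-- same block of Π^cyc (a graph on k nodes: walks of length ≤ k suffice)
cycConn : ∀ {k} → Partition k → Fin k → Fin k → Bool
cycConn {k} Π i j = reach Π k i j

cycSize : ∀ {k} → Partition k → Fin k → ℕ
cycSize Π i = count (λ j → cycConn Π i j)

-- |Π^cyc| : number of blocks of Π^cyc, counted via their least elements
numCyc : ∀ {k} → Partition k → ℕ
numCyc Π = count (λ i → Data.Bool.not (anyᶠ (λ j → ⌊ Data.Nat._<?_ (toℕ j) (toℕ i) ⌋ ∧ cycConn Π i j)))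

⌈_/_⌉ : ℕ → ℕ → ℕ
⌈ k / zero ⌉ = 0
⌈ k / suc q ⌉ = (k + q) / suc q

cycDist : ∀ {k} → Fin k → Fin k → ℕ
cycDist {suc n} i j =
  Data.Nat._⊓_ (toℕ ((toℕ i + (suc n ∸ toℕ j)) mod suc n))
               (toℕ ((toℕ j + (suc n ∸ toℕ i)) mod suc n))

lhs : ∀ {k} → Partition k → ℕ → ℤ
lhs Π q = sumℤ (λ i → ℤ.+ x Π i (i ⊕ 1) ℤ.- ℤ.+ x Π i (i ⊕ q))

condA : ∀ {k} → Partition k → ℕ → Set
condA {k} Π q =
  (numCyc Π ≡ ⌈ k / q ⌉)
  Data.Product.× (∀ i → cycSize Π i ≤ q)
  Data.Product.× (∀ i j → sameBlock Π i j ≡ true → cycConn Π i j ≡ false → q < cycDist i j)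

condB : ∀ {k} → Partition k → ℕ → Set
condB {k} Π q =
  (numCyc Π ≡ ⌈ k / q ⌉ ∸ 1)
  Data.Product.× (Data.Product.Σ (Fin k) λ u →
       (cycSize Π u ≡ suc q)
       Data.Product.× (∀ v → cycConn Π u v ≡ false → cycSize Π v ≡ q))

-- Call a position a a cut if a and a + 1 lie in different blocks, let C be the number of cuts
-- and Z the number of a with a and a + q in different blocks; the left-hand side is Z − C.
-- A window a, …, a + q − 1 without cuts puts a and a + q in one block, so Z is at most the
-- number of pairs (window, cut in it), which is q·C; also Z ≤ k.  As (⌈k/q⌉ − 1)·q < k, the two
-- bounds give Z − C ≤ k − ⌈k/q⌉.  The blocks of Π^cyc are the maximal cut-free runs, so
-- |Π^cyc| = C whenever C ≥ 1.  Equality with C ≥ ⌈k/q⌉ forces C = ⌈k/q⌉ and Z = k; a block that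
-- comes back within distance q of one of its runs would then create a pair at distance exactly q
-- or too many cuts, which gives (a).  Equality with C < ⌈k/q⌉ forces C = ⌈k/q⌉ − 1, Z = q·C and
-- k = q·C + 1: every window holds at most one cut and exactly one holds none, which gives (b).

module Submission where

open import Defs
open import Data.Bool using (Bool; true; false; _∨_; _∧_; not; if_then_else_; T)
open import Data.Bool.Properties using (∧-zeroʳ)
open import Data.Empty using (⊥; ⊥-elim)
open import Data.Fin as F using (Fin; toℕ)
open import Data.Fin.Properties using (toℕ-fromℕ<; toℕ-injective; toℕ<n) renaming (_≟_ to _≟ᶠ_)
open import Data.Integer as ℤ using (ℤ)
import Data.Integer.Properties as ℤP
open import Data.Integer.Tactic.RingSolver as ℤSolver using ()
open import Data.List using (foldr; tabulate)
open import Data.List.Properties using (map-tabulate)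
open import Data.Nat
open import Data.Nat.DivMod
open import Data.Nat.Properties
open import Data.Nat.Tactic.RingSolver using (solve-∀)
open import Data.Product using (Σ; _×_; _,_; proj₁; proj₂)
open import Data.Sum using (_⊎_; inj₁; inj₂)
open import Data.Unit using (tt)
open import Function using (id; _∘_)
open import Function.Bundles using (_⇔_; mk⇔)
open import Function.Properties.Equivalence using () renaming (trans to ⇔-trans)
open import Relation.Binary.Definitions using (tri<; tri≈; tri>)
open import Relation.Binary.PropositionalEquality
open import Relation.Nullary using (¬_; yes; no)
open import Relation.Nullary.Decidable using (⌊_⌋)

ind : Bool → ℕ
ind b = if b then 1 else 0

ind≤1 : ∀ b → ind b ≤ 1
ind≤1 true = s≤s z≤n
ind≤1 false = z≤n

∑ : ℕ → (ℕ → ℕ) → ℕ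
∑ zero F = 0
∑ (suc N) F = F 0 + ∑ N (λ t → F (suc t))

∑-cong : ∀ N {F G : ℕ → ℕ} → (∀ t → t < N → F t ≡ G t) → ∑ N F ≡ ∑ N G
∑-cong zero h = refl
∑-cong (suc N) h = cong₂ _+_ (h 0 (s≤s z≤n)) (∑-cong N (λ t p → h (suc t) (s≤s p)))

∑-snoc : ∀ N F → ∑ (suc N) F ≡ ∑ N F + F N
∑-snoc zero F = +-comm (F 0) 0
∑-snoc (suc N) F = trans (cong (F 0 +_) (∑-snoc N (λ t → F (suc t)))) (sym (+-assoc (F 0) _ _))

∑-distrib-+ : ∀ N F G → ∑ N (λ t → F t + G t) ≡ ∑ N F + ∑ N G
∑-distrib-+ zero F G = refl
∑-distrib-+ (suc N) F G = trans (cong (F 0 + G 0 +_) (∑-distrib-+ N _ _)) (exchange (F 0) (G 0) _ _)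
  where
  exchange : ∀ a b c d → a + b + (c + d) ≡ a + c + (b + d)
  exchange = solve-∀

∑-const : ∀ N c → ∑ N (λ _ → c) ≡ N * c
∑-const zero c = refl
∑-const (suc N) c = cong (c +_) (∑-const N c)

∑-split : ∀ M N F → ∑ (M + N) F ≡ ∑ M F + ∑ N (λ t → F (M + t))
∑-split zero N F = refl
∑-split (suc M) N F = trans (cong (F 0 +_) (∑-split M N (λ t → F (suc t)))) (sym (+-assoc (F 0) _ _))

∑-mono-≤ : ∀ N {F G : ℕ → ℕ} → (∀ t → t < N → F t ≤ G t) → ∑ N F ≤ ∑ N G
∑-mono-≤ zero h = z≤n
∑-mono-≤ (suc N) h = +-mono-≤ (h 0 (s≤s z≤n)) (∑-mono-≤ N (λ t p → h (suc t) (s≤s p)))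

∑-≥-const : ∀ N F c → (∀ t → t < N → c ≤ F t) → N * c ≤ ∑ N F
∑-≥-const N F c h = subst (_≤ ∑ N F) (∑-const N c) (∑-mono-≤ N h)

∑-comm : ∀ N M (F : ℕ → ℕ → ℕ) → ∑ N (λ i → ∑ M (F i)) ≡ ∑ M (λ t → ∑ N (λ i → F i t))
∑-comm zero M F = sym (trans (∑-const M 0) (*-zeroʳ M))
∑-comm (suc N) M F =
  trans (cong (∑ M (F 0) +_) (∑-comm N M (λ i → F (suc i))))
        (sym (∑-distrib-+ M (F 0) (λ t → ∑ N (λ i → F (suc i) t))))

∑-≡⇒pointwise : ∀ N F G → (∀ t → t < N → F t ≤ G t) → ∑ N F ≡ ∑ N G → ∀ t → t < N → F t ≡ G t
∑-≡⇒pointwise zero F G _ _ t ()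
∑-≡⇒pointwise (suc N) F G F≤G sums≡ = pointwise
  where
  tails≤ : ∑ N (λ t → F (suc t)) ≤ ∑ N (λ t → G (suc t))
  tails≤ = ∑-mono-≤ N (λ t p → F≤G (suc t) (s≤s p))
  heads≡ : F 0 ≡ G 0
  heads≡ = ≤-antisym (F≤G 0 (s≤s z≤n))
    (+-cancelʳ-≤ (∑ N (λ t → F (suc t))) (G 0) (F 0)
      (≤-trans (+-monoʳ-≤ (G 0) tails≤) (≤-reflexive (sym sums≡))))
  tails≡ : ∑ N (λ t → F (suc t)) ≡ ∑ N (λ t → G (suc t))
  tails≡ = +-cancelˡ-≡ (G 0) _ _ (trans (cong (_+ ∑ N (λ t → F (suc t))) (sym heads≡)) sums≡)
  pointwise : ∀ t → t < suc N → F t ≡ G t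
  pointwise zero _ = heads≡
  pointwise (suc t) (s≤s p) =
    ∑-≡⇒pointwise N (λ t → F (suc t)) (λ t → G (suc t)) (λ t p → F≤G (suc t) (s≤s p)) tails≡ t p

∑-prefix+term-≤ : ∀ N F t → t < N → ∑ t F + F t ≤ ∑ N F
∑-prefix+term-≤ (suc N) F zero _ = m≤m+n (F 0) _
∑-prefix+term-≤ (suc N) F (suc t) (s≤s p) =
  subst (_≤ ∑ (suc N) F) (sym (+-assoc (F 0) _ _))
        (+-monoʳ-≤ (F 0) (∑-prefix+term-≤ N (λ t → F (suc t)) t p))

∑-term-≤ : ∀ N F t → t < N → F t ≤ ∑ N F
∑-term-≤ N F t p = ≤-trans (m≤n+m (F t) (∑ t F)) (∑-prefix+term-≤ N F t p)

∑-prefix-≤ : ∀ M N F → M ≤ N → ∑ M F ≤ ∑ N F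
∑-prefix-≤ M N F M≤N with m≤n⇒∃[o]m+o≡n M≤N
... | o , refl = subst (_≤ ∑ (M + o) F) (+-identityʳ (∑ M F))
                   (subst (∑ M F + 0 ≤_) (sym (∑-split M o F)) (+-monoʳ-≤ (∑ M F) z≤n))

∑-≤-support : ∀ N D F → (∀ t → D ≤ t → t < N → F t ≡ 0) → (∀ t → t < N → F t ≤ 1) → ∑ N F ≤ D
∑-≤-support zero D F vanish F≤1 = z≤n
∑-≤-support (suc N) zero F vanish F≤1 =
  ≤-reflexive (trans (∑-cong (suc N) (λ t p → vanish t z≤n p)) (trans (∑-const (suc N) 0) (*-zeroʳ (suc N))))
∑-≤-support (suc N) (suc D) F vanish F≤1 =
  +-mono-≤ (F≤1 0 (s≤s z≤n))
           (∑-≤-support N D (λ t → F (suc t)) (λ t p q → vanish (suc t) (s≤s p) (s≤s q)) (λ t p → F≤1 (suc t) (s≤s p)))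

2≤∑ : ∀ N F t₁ t₂ → t₁ < t₂ → t₂ < N → 1 ≤ F t₁ → 1 ≤ F t₂ → 2 ≤ ∑ N F
2≤∑ N F t₁ t₂ t₁<t₂ t₂<N F₁ F₂ =
  ≤-trans (+-mono-≤ (≤-trans F₁ (∑-term-≤ t₂ F t₁ t₁<t₂)) F₂) (∑-prefix+term-≤ N F t₂ t₂<N)

3≤∑ : ∀ N F t₁ t₂ t₃ → t₁ < t₂ → t₂ < t₃ → t₃ < N → 1 ≤ F t₁ → 1 ≤ F t₂ → 1 ≤ F t₃ → 3 ≤ ∑ N F
3≤∑ N F t₁ t₂ t₃ t₁<t₂ t₂<t₃ t₃<N F₁ F₂ F₃ =
  ≤-trans (+-mono-≤ (2≤∑ t₃ F t₁ t₂ t₁<t₂ t₂<t₃ F₁ F₂) F₃) (∑-prefix+term-≤ N F t₃ t₃<N)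

Periodic : ℕ → (ℕ → ℕ) → Set
Periodic N F = ∀ t → F (N + t) ≡ F t

∑-rotate₁ : ∀ N F → Periodic N F → ∑ N (λ t → F (suc t)) ≡ ∑ N F
∑-rotate₁ zero F p = refl
∑-rotate₁ (suc N) F p = begin
  ∑ (suc N) (λ t → F (suc t))         ≡⟨ ∑-snoc N (λ t → F (suc t)) ⟩
  ∑ N (λ t → F (suc t)) + F (suc N)   ≡⟨ cong (∑ N (λ t → F (suc t)) +_) wrap ⟩
  ∑ N (λ t → F (suc t)) + F 0         ≡⟨ +-comm _ (F 0) ⟩
  ∑ (suc N) F                         ∎
  where
  open ≡-Reasoning
  wrap : F (suc N) ≡ F 0
  wrap = trans (cong F (sym (+-identityʳ (suc N)))) (p 0)

∑-rotate : ∀ N F a → Periodic N F → ∑ N (λ t → F (a + t)) ≡ ∑ N F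
∑-rotate N F zero p = refl
∑-rotate N F (suc a) p =
  trans (∑-cong N (λ t _ → cong F (sym (+-suc a t))))
        (trans (∑-rotate₁ N (λ t → F (a + t)) shifted-periodic) (∑-rotate N F a p))
  where
  shifted-periodic : Periodic N (λ t → F (a + t))
  shifted-periodic t = trans (cong F (trans (sym (+-assoc a N t)) (trans (cong (_+ t) (+-comm a N)) (+-assoc N a t))))
                             (p (a + t))

contradictionᵇ : ∀ {A : Set} {b : Bool} → b ≡ true → b ≡ false → A
contradictionᵇ refl ()

∨-introˡ : ∀ x y → x ≡ true → x ∨ y ≡ true
∨-introˡ true y _ = refl

∨-introʳ : ∀ x y → y ≡ true → x ∨ y ≡ true
∨-introʳ true y _ = refl
∨-introʳ false y e = e

∨-elim : ∀ x y → x ∨ y ≡ true → x ≡ true ⊎ y ≡ true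
∨-elim true y _ = inj₁ refl
∨-elim false y e = inj₂ e

∨-false : ∀ x y → x ∨ y ≡ false → x ≡ false × y ≡ false
∨-false false y e = refl , e

∧-intro : ∀ {x y} → x ≡ true → y ≡ true → x ∧ y ≡ true
∧-intro refl refl = refl

∧-elim : ∀ x y → x ∧ y ≡ true → x ≡ true × y ≡ true
∧-elim true true _ = refl , refl

not-true : ∀ {b} → b ≡ true → not b ≡ false
not-true refl = refl

not-false : ∀ {b} → b ≡ false → not b ≡ true
not-false refl = refl

any< : ℕ → (ℕ → Bool) → Bool
any< zero b = false
any< (suc N) b = b 0 ∨ any< N (λ t → b (suc t))

count< : ℕ → (ℕ → Bool) → ℕ
count< N b = ∑ N (λ t → ind (b t))

any<-intro : ∀ N b t → t < N → b t ≡ true → any< N b ≡ true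
any<-intro (suc N) b zero _ e = ∨-introˡ (b 0) _ e
any<-intro (suc N) b (suc t) (s≤s p) e = ∨-introʳ (b 0) _ (any<-intro N (λ t → b (suc t)) t p e)

any<-elim : ∀ N b → any< N b ≡ true → Σ ℕ λ t → t < N × b t ≡ true
any<-elim (suc N) b e with ∨-elim (b 0) _ e
... | inj₁ e0 = 0 , s≤s z≤n , e0
... | inj₂ er with any<-elim N (λ t → b (suc t)) er
... | t , p , q = suc t , s≤s p , q

any<-false-elim : ∀ N b → any< N b ≡ false → ∀ t → t < N → b t ≡ false
any<-false-elim (suc N) b e zero _ = proj₁ (∨-false (b 0) _ e)
any<-false-elim (suc N) b e (suc t) (s≤s p) =
  any<-false-elim N (λ t → b (suc t)) (proj₂ (∨-false (b 0) _ e)) t p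

any<-false-intro : ∀ N b → (∀ t → t < N → b t ≡ false) → any< N b ≡ false
any<-false-intro zero b h = refl
any<-false-intro (suc N) b h rewrite h 0 (s≤s z≤n) =
  any<-false-intro N (λ t → b (suc t)) (λ t p → h (suc t) (s≤s p))

first< : ∀ N b → any< N b ≡ true →
         Σ ℕ λ t → t < N × b t ≡ true × (∀ u → u < t → b u ≡ false)
first< (suc N) b e with b 0 in eq0
... | true = 0 , s≤s z≤n , eq0 , (λ u ())
... | false with first< N (λ t → b (suc t)) e
... | t , p , q , r = suc t , s≤s p , q , λ { zero _ → eq0 ; (suc u) (s≤s u<t) → r u u<t }

last< : ∀ N b → any< N b ≡ true →
        Σ ℕ λ t → t < N × b t ≡ true × (∀ u → t < u → u < N → b u ≡ false)
last< (suc N) b e with any< N (λ t → b (suc t)) in er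
... | true with last< N (λ t → b (suc t)) er
... | t , p , q , r = suc t , s≤s p , q , λ { zero () ; (suc u) (s≤s tu) (s≤s uN) → r u tu uN }
last< (suc N) b e | false with b 0 in eq0
... | true = 0 , s≤s z≤n , eq0 , λ { zero () ; (suc u) _ (s≤s uN) → any<-false-elim N (λ t → b (suc t)) er u uN }
... | false = contradictionᵇ e refl

count<-none : ∀ N b → any< N b ≡ false → count< N b ≡ 0
count<-none zero b e = refl
count<-none (suc N) b e rewrite proj₁ (∨-false (b 0) _ e) =
  count<-none N (λ t → b (suc t)) (proj₂ (∨-false (b 0) _ e))

count<≡0⇒none : ∀ N b → count< N b ≡ 0 → ∀ t → t < N → b t ≡ false
count<≡0⇒none N b none t t<N with b t in bt
... | false = refl
... | true with subst (1 ≤_) none (≤-trans (≤-reflexive (cong ind (sym bt))) (∑-term-≤ N (λ t → ind (b t)) t t<N))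
... | ()

any<⇒1≤count< : ∀ N b → any< N b ≡ true → 1 ≤ count< N b
any<⇒1≤count< N b e with any<-elim N b e
... | t , t<N , bt = ≤-trans (≤-reflexive (cong ind (sym bt))) (∑-term-≤ N (λ t → ind (b t)) t t<N)

1≤count<⇒any< : ∀ N b → 1 ≤ count< N b → any< N b ≡ true
1≤count<⇒any< N b p with any< N b in e
... | true = refl
... | false with subst (1 ≤_) (count<-none N b e) p
... | ()

count<-nonlast : ∀ N b → ∑ N (λ t → ind (b t ∧ any< (N ∸ suc t) (λ s → b (suc t + s)))) ≡ count< N b ∸ 1
count<-nonlast zero b = refl
count<-nonlast (suc N) b with b 0
... | false = count<-nonlast N (λ t → b (suc t))
... | true with any< N (λ t → b (suc t)) in e
... | false = trans (count<-nonlast N (λ t → b (suc t)))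
                    (trans (cong (_∸ 1) (count<-none N _ e)) (sym (count<-none N _ e)))
... | true = trans (cong (1 +_) (count<-nonlast N (λ t → b (suc t)))) (m+[n∸m]≡n (any<⇒1≤count< N _ e))

2≤count<⇒pair : ∀ N b → 2 ≤ count< N b →
                Σ ℕ λ t₁ → Σ ℕ λ t₂ → t₁ < t₂ × t₂ < N × b t₁ ≡ true × b t₂ ≡ true
2≤count<⇒pair (suc N) b p with b 0 in eq0
... | true with any<-elim N (λ t → b (suc t)) (1≤count<⇒any< N _ (s≤s⁻¹ p))
... | t , tl , e = 0 , suc t , s≤s z≤n , s≤s tl , eq0 , e
2≤count<⇒pair (suc N) b p | false with 2≤count<⇒pair N (λ t → b (suc t)) p
... | t₁ , t₂ , a , c , d , e = suc t₁ , suc t₂ , s≤s a , s≤s c , d , e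

count<≤1⇒unique : ∀ N b → count< N b ≤ 1 → ∀ t → t < N → b t ≡ true →
                  ∀ u → u < N → u ≢ t → b u ≡ false
count<≤1⇒unique N b atMostOne t t<N bt u u<N u≢t with b u in bu
... | false = refl
... | true with <-cmp u t
... | tri< u<t _ _ = ⊥-elim (<⇒≱ (2≤∑ N _ u t u<t t<N (≤-reflexive (cong ind (sym bu))) (≤-reflexive (cong ind (sym bt)))) atMostOne)
... | tri≈ _ u≡t _ = ⊥-elim (u≢t u≡t)
... | tri> _ _ t<u = ⊥-elim (<⇒≱ (2≤∑ N _ t u t<u u<N (≤-reflexive (cong ind (sym bt))) (≤-reflexive (cong ind (sym bu)))) atMostOne)

∑ℤ : ℕ → (ℕ → ℤ) → ℤ
∑ℤ zero F = ℤ.+ 0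
∑ℤ (suc N) F = F 0 ℤ.+ ∑ℤ N (λ t → F (suc t))

∑ℤ-split : ∀ N F G → ∑ℤ N (λ t → ℤ.+ F t ℤ.- ℤ.+ G t) ≡ ℤ.+ ∑ N F ℤ.- ℤ.+ ∑ N G
∑ℤ-split zero F G = refl
∑ℤ-split (suc N) F G =
  trans (cong (λ z → (ℤ.+ F 0 ℤ.- ℤ.+ G 0) ℤ.+ z) (∑ℤ-split N (λ t → F (suc t)) (λ t → G (suc t))))
    (trans (regroup (ℤ.+ F 0) (ℤ.+ G 0) (ℤ.+ ∑ N (λ t → F (suc t))) (ℤ.+ ∑ N (λ t → G (suc t))))
           (sym (cong₂ ℤ._-_ (ℤP.pos-+ (F 0) _) (ℤP.pos-+ (G 0) _))))
  where
  regroup : ∀ a b c d → (a ℤ.- b) ℤ.+ (c ℤ.- d) ≡ (a ℤ.+ c) ℤ.- (b ℤ.+ d)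
  regroup = ℤSolver.solve-∀

sumℕ≡∑ : ∀ {N} (f : Fin N → ℕ) (G : ℕ → ℕ) → (∀ i → f i ≡ G (toℕ i)) → sumℕ f ≡ ∑ N G
sumℕ≡∑ {N} f G h = trans (cong (foldr _+_ 0) (map-tabulate id f)) (go N (f ∘ id) G h)
  where
  go : ∀ N (g : Fin N → ℕ) (G : ℕ → ℕ) → (∀ i → g i ≡ G (toℕ i)) → foldr _+_ 0 (tabulate g) ≡ ∑ N G
  go zero g G h = refl
  go (suc N) g G h = cong₂ _+_ (h F.zero) (go N (g ∘ F.suc) (λ t → G (suc t)) (λ i → h (F.suc i)))

sumℤ≡∑ℤ : ∀ {N} (f : Fin N → ℤ) (G : ℕ → ℤ) → (∀ i → f i ≡ G (toℕ i)) → sumℤ f ≡ ∑ℤ N G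
sumℤ≡∑ℤ {N} f G h = trans (cong (foldr ℤ._+_ (ℤ.+ 0)) (map-tabulate id f)) (go N (f ∘ id) G h)
  where
  go : ∀ N (g : Fin N → ℤ) (G : ℕ → ℤ) → (∀ i → g i ≡ G (toℕ i)) → foldr ℤ._+_ (ℤ.+ 0) (tabulate g) ≡ ∑ℤ N G
  go zero g G h = refl
  go (suc N) g G h = cong₂ ℤ._+_ (h F.zero) (go N (g ∘ F.suc) (λ t → G (suc t)) (λ i → h (F.suc i)))

module _ {N : ℕ} (p : Fin N → Bool) where

  private
    anyᶠ≡foldr : anyᶠ p ≡ foldr _∨_ false (tabulate p)
    anyᶠ≡foldr = cong (foldr _∨_ false) (map-tabulate id p)

    foldr-intro : ∀ N (g : Fin N → Bool) l → g l ≡ true → foldr _∨_ false (tabulate g) ≡ true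
    foldr-intro (suc N) g F.zero e = ∨-introˡ (g F.zero) _ e
    foldr-intro (suc N) g (F.suc l) e = ∨-introʳ (g F.zero) _ (foldr-intro N (g ∘ F.suc) l e)

    foldr-elim : ∀ N (g : Fin N → Bool) → foldr _∨_ false (tabulate g) ≡ true → Σ (Fin N) λ l → g l ≡ true
    foldr-elim (suc N) g e with ∨-elim (g F.zero) _ e
    ... | inj₁ p = F.zero , p
    ... | inj₂ p with foldr-elim N (g ∘ F.suc) p
    ... | l , q = F.suc l , q

    foldr-false : ∀ N (g : Fin N → Bool) → (∀ l → g l ≡ false) → foldr _∨_ false (tabulate g) ≡ false
    foldr-false zero g h = refl
    foldr-false (suc N) g h rewrite h F.zero = foldr-false N (g ∘ F.suc) (λ l → h (F.suc l))

  anyᶠ-intro : ∀ l → p l ≡ true → anyᶠ p ≡ true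
  anyᶠ-intro l e = trans anyᶠ≡foldr (foldr-intro N p l e)

  anyᶠ-elim : anyᶠ p ≡ true → Σ (Fin N) λ l → p l ≡ true
  anyᶠ-elim e = foldr-elim N p (trans (sym anyᶠ≡foldr) e)

  anyᶠ-false : (∀ l → p l ≡ false) → anyᶠ p ≡ false
  anyᶠ-false h = trans anyᶠ≡foldr (foldr-false N p h)

≡ᵇ-true⇒≡ : ∀ {m m'} → (m ≡ᵇ m') ≡ true → m ≡ m'
≡ᵇ-true⇒≡ {m} {m'} e = ≡ᵇ⇒≡ m m' (subst T (sym e) tt)

≡⇒≡ᵇ-true : ∀ {m m'} → m ≡ m' → (m ≡ᵇ m') ≡ true
≡⇒≡ᵇ-true {m} {m'} e with m ≡ᵇ m' | ≡⇒≡ᵇ m m' e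
... | true | _ = refl

≡ᵇ-false⇒≢ : ∀ {m m'} → (m ≡ᵇ m') ≡ false → m ≢ m'
≡ᵇ-false⇒≢ e p = contradictionᵇ (≡⇒≡ᵇ-true p) e

≢⇒≡ᵇ-false : ∀ {m m'} → m ≢ m' → (m ≡ᵇ m') ≡ false
≢⇒≡ᵇ-false {m} {m'} ne with m ≡ᵇ m' in q
... | false = refl
... | true = ⊥-elim (ne (≡ᵇ-true⇒≡ q))

==-intro : ∀ {N} {i j : Fin N} → i ≡ j → (i == j) ≡ true
==-intro {i = i} {j} e with i ≟ᶠ j
... | yes _ = refl
... | no i≢j = ⊥-elim (i≢j e)

==-elim : ∀ {N} {i j : Fin N} → (i == j) ≡ true → i ≡ j
==-elim {i = i} {j} e with i ≟ᶠ j
... | yes i≡j = i≡j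

<ᵇ-false : ∀ a b → ¬ (a < b) → ⌊ a <? b ⌋ ≡ false
<ᵇ-false a b a≮b with a <? b
... | no _ = refl
... | yes a<b = ⊥-elim (a≮b a<b)

<ᵇ-true : ∀ a b → a < b → ⌊ a <? b ⌋ ≡ true
<ᵇ-true a b a<b with a <? b
... | yes _ = refl
... | no a≮b = ⊥-elim (a≮b a<b)

module Cycle (n : ℕ) where

  k : ℕ
  k = suc n

  node : ℕ → Fin k
  node m = m mod k

  toℕ-node : ∀ m → toℕ (node m) ≡ m % k
  toℕ-node m = toℕ-fromℕ< _

  toℕ-node-< : ∀ m → m < k → toℕ (node m) ≡ m
  toℕ-node-< m m<k = trans (toℕ-node m) (m<n⇒m%n≡m m<k)

  %-≡⇒node-≡ : ∀ m m' → m % k ≡ m' % k → node m ≡ node m'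
  %-≡⇒node-≡ m m' e = toℕ-injective (trans (toℕ-node m) (trans e (sym (toℕ-node m'))))

  node-≡⇒%-≡ : ∀ m m' → node m ≡ node m' → m % k ≡ m' % k
  node-≡⇒%-≡ m m' e = trans (sym (toℕ-node m)) (trans (cong toℕ e) (toℕ-node m'))

  node-toℕ : ∀ i → node (toℕ i) ≡ i
  node-toℕ i = toℕ-injective (toℕ-node-< (toℕ i) (toℕ<n i))

  %-reduceˡ : ∀ a d → (a % k + d) % k ≡ (a + d) % k
  %-reduceˡ a d = begin
    (a % k + d) % k            ≡⟨ %-distribˡ-+ (a % k) d k ⟩
    (a % k % k + d % k) % k    ≡⟨ cong (λ v → (v + d % k) % k) (m%n%n≡m%n a k) ⟩
    (a % k + d % k) % k        ≡⟨ %-distribˡ-+ a d k ⟨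
    (a + d) % k                ∎
    where open ≡-Reasoning

  %-reduceʳ : ∀ a d → (a + d % k) % k ≡ (a + d) % k
  %-reduceʳ a d = trans (cong (_% k) (+-comm a (d % k))) (trans (%-reduceˡ d a) (cong (_% k) (+-comm d a)))

  node-reduce : ∀ a d → node (toℕ (node a) + d) ≡ node (a + d)
  node-reduce a d = %-≡⇒node-≡ (toℕ (node a) + d) (a + d)
                      (trans (cong (λ v → (v + d) % k) (toℕ-node a)) (%-reduceˡ a d))

  node-k+ : ∀ a → node (k + a) ≡ node a
  node-k+ a = %-≡⇒node-≡ (k + a) a (trans (cong (_% k) (+-comm k a)) ([m+n]%n≡m%n a k))

  ⊕-node : ∀ a d → node a ⊕ d ≡ node (a + d)
  ⊕-node = node-reduce

  node-node : ∀ m → node (toℕ (node m)) ≡ node m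
  node-node m = node-toℕ (node m)

  ⊕-assoc : ∀ (i : Fin k) a b → (i ⊕ a) ⊕ b ≡ i ⊕ (a + b)
  ⊕-assoc i a b = trans (node-reduce (toℕ i + a) b) (cong node (+-assoc (toℕ i) a b))

  ⊕-identityʳ : ∀ (i : Fin k) → i ⊕ 0 ≡ i
  ⊕-identityʳ i = trans (cong node (+-identityʳ (toℕ i))) (node-toℕ i)

  ⊕-suc : ∀ (i : Fin k) d → i ⊕ suc d ≡ (i ⊕ d) ⊕ 1
  ⊕-suc i d = trans (cong (i ⊕_) (+-comm 1 d)) (sym (⊕-assoc i d 1))

  ⊕-% : ∀ (i : Fin k) d → i ⊕ (d % k) ≡ i ⊕ d
  ⊕-% i d = %-≡⇒node-≡ (toℕ i + d % k) (toℕ i + d) (%-reduceʳ (toℕ i) d)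

  %-cancelˡ : ∀ X a b → (X + a) % k ≡ (X + b) % k → a % k ≡ b % k
  %-cancelˡ X a b e = begin
    a % k                              ≡⟨ shift a ⟨
    (X + a + X * n) % k                ≡⟨ %-distribˡ-+ (X + a) (X * n) k ⟩
    ((X + a) % k + X * n % k) % k      ≡⟨ cong (λ v → (v + X * n % k) % k) e ⟩
    ((X + b) % k + X * n % k) % k      ≡⟨ %-distribˡ-+ (X + b) (X * n) k ⟨
    (X + b + X * n) % k                ≡⟨ shift b ⟩
    b % k                              ∎
    where
    open ≡-Reasoning
    rearrange : ∀ X c n → X + c + X * n ≡ c + X * suc n
    rearrange = solve-∀
    shift : ∀ c → (X + c + X * n) % k ≡ c % k
    shift c = trans (cong (_% k) (rearrange X c n)) ([m+kn]%n≡m%n c X k)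

  node-cancelˡ : ∀ X a b → node (X + a) ≡ node (X + b) → a % k ≡ b % k
  node-cancelˡ X a b e = %-cancelˡ X a b (node-≡⇒%-≡ (X + a) (X + b) e)

  node-≡⇒residue≤ : ∀ X d r → node (X + d) ≡ node (X + r) → r < k → r ≤ d
  node-≡⇒residue≤ X d r e r<k = subst (_≤ d) (trans (node-cancelˡ X d r e) (m<n⇒m%n≡m r<k)) (m%n≤m d k)

  ⊕-cancelʳ : ∀ (i j : Fin k) d → i ⊕ d ≡ j ⊕ d → i ≡ j
  ⊕-cancelʳ i j d e = toℕ-injective (begin
    toℕ i                 ≡⟨ m<n⇒m%n≡m (toℕ<n i) ⟨
    toℕ i % k             ≡⟨ %-cancelˡ d (toℕ i) (toℕ j) residues ⟩
    toℕ j % k             ≡⟨ m<n⇒m%n≡m (toℕ<n j) ⟩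
    toℕ j                 ∎)
    where
    open ≡-Reasoning
    residues : (d + toℕ i) % k ≡ (d + toℕ j) % k
    residues = trans (cong (_% k) (+-comm d (toℕ i)))
                 (trans (node-≡⇒%-≡ (toℕ i + d) (toℕ j + d) e) (cong (_% k) (+-comm (toℕ j) d)))

  node-offset : ∀ s (j : Fin k) → Σ ℕ λ t → t < k × node (s + t) ≡ j
  node-offset zero j = toℕ j , toℕ<n j , node-toℕ j
  node-offset (suc s) j with node-offset s j
  ... | zero , _ , e = n , n<1+n n , trans (cong node (trans (sym (+-suc s n)) (+-comm s k)))
                                        (trans (node-k+ s) (trans (cong node (sym (+-identityʳ s))) e))
  ... | suc t , t<k , e = t , <-trans (n<1+n t) t<k , trans (cong node (sym (+-suc s t))) e

  offset : Fin k → Fin k → ℕ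
  offset i j = toℕ ((toℕ j + (k ∸ toℕ i)) mod k)

  ⊕-offset : ∀ (i j : Fin k) → i ⊕ offset i j ≡ j
  ⊕-offset i j = begin
    i ⊕ toℕ (node m)      ≡⟨ cong (i ⊕_) (toℕ-node m) ⟩
    i ⊕ (m % k)           ≡⟨ ⊕-% i m ⟩
    node (toℕ i + m)      ≡⟨ cong node wraps ⟩
    node (k + toℕ j)      ≡⟨ node-k+ (toℕ j) ⟩
    node (toℕ j)          ≡⟨ node-toℕ j ⟩
    j                     ∎
    where
    open ≡-Reasoning
    m = toℕ j + (k ∸ toℕ i)
    wraps : toℕ i + m ≡ k + toℕ j
    wraps = trans (cong (toℕ i +_) (+-comm (toℕ j) (k ∸ toℕ i)))
              (trans (sym (+-assoc (toℕ i) (k ∸ toℕ i) (toℕ j))) (cong (_+ toℕ j) (m+[n∸m]≡n (<⇒≤ (toℕ<n i)))))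

  cycDist-⊕ : ∀ (i : Fin k) d → d < k → cycDist i (i ⊕ d) ≤ d
  cycDist-⊕ i d d<k = ≤-trans (m⊓n≤n _ _) (≤-reflexive forward)
    where
    open ≡-Reasoning
    wraps : toℕ i + d + (k ∸ toℕ i) ≡ k + d
    wraps = trans (+-assoc (toℕ i) d (k ∸ toℕ i))
              (trans (cong (toℕ i +_) (+-comm d (k ∸ toℕ i)))
                (trans (sym (+-assoc (toℕ i) (k ∸ toℕ i) d)) (cong (_+ d) (m+[n∸m]≡n (<⇒≤ (toℕ<n i))))))
    forward : offset i (i ⊕ d) ≡ d
    forward = begin
      toℕ (node (toℕ (node (toℕ i + d)) + (k ∸ toℕ i)))  ≡⟨ cong toℕ (node-reduce (toℕ i + d) (k ∸ toℕ i)) ⟩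
      toℕ (node (toℕ i + d + (k ∸ toℕ i)))               ≡⟨ cong (toℕ ∘ node) wraps ⟩
      toℕ (node (k + d))                                 ≡⟨ cong toℕ (node-k+ d) ⟩
      toℕ (node d)                                       ≡⟨ toℕ-node-< d d<k ⟩
      d                                                  ∎

module Blocks (n : ℕ) (Π : Partition (suc n)) where

  open Cycle n

  block : ℕ → ℕ
  block a = Π (node a)

  block-k+ : ∀ a → block (k + a) ≡ block a
  block-k+ a = cong Π (node-k+ a)

  block-reduce : ∀ a t → block (toℕ (node a) + t) ≡ block (a + t)
  block-reduce a t = cong Π (node-reduce a t)

  block-toℕ : ∀ i → block (toℕ i) ≡ Π i
  block-toℕ i = cong Π (node-toℕ i)

  isCut : ℕ → Bool
  isCut a = not (block a ≡ᵇ block (suc a))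

  cut : ℕ → ℕ
  cut a = ind (isCut a)

  isCut-k+ : ∀ a → isCut (k + a) ≡ isCut a
  isCut-k+ a = cong₂ (λ u v → not (u ≡ᵇ v)) (block-k+ a) (trans (cong block (sym (+-suc k a))) (block-k+ (suc a)))

  cut-periodic : Periodic k cut
  cut-periodic a = cong ind (isCut-k+ a)

  isCut-false⇒≡ : ∀ {a} → isCut a ≡ false → block a ≡ block (suc a)
  isCut-false⇒≡ {a} e with block a ≡ᵇ block (suc a) in q
  ... | true = ≡ᵇ-true⇒≡ q

  isCut-true⇒≢ : ∀ {a} → isCut a ≡ true → ¬ block a ≡ block (suc a)
  isCut-true⇒≢ {a} e with block a ≡ᵇ block (suc a) in q
  ... | false = ≡ᵇ-false⇒≢ q

  ≡⇒isCut-false : ∀ {a} → block a ≡ block (suc a) → isCut a ≡ false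
  ≡⇒isCut-false {a} p rewrite ≡⇒≡ᵇ-true p = refl

  record CutFree (a d : ℕ) : Set where
    constructor mkCutFree
    field link : ∀ t → t < d → block (a + t) ≡ block (a + suc t)
  open CutFree public

  CutFree⇒isCut-false : ∀ {a d} → CutFree a d → ∀ t → t < d → isCut (a + t) ≡ false
  CutFree⇒isCut-false {a} h t p = ≡⇒isCut-false (trans (link h t p) (cong block (+-suc a t)))

  isCut-false⇒CutFree : ∀ {a d} → (∀ t → t < d → isCut (a + t) ≡ false) → CutFree a d
  isCut-false⇒CutFree {a} h = mkCutFree λ t p → trans (isCut-false⇒≡ (h t p)) (cong block (sym (+-suc a t)))

  CutFree⇒block-≡ : ∀ {a d} → CutFree a d → ∀ t → t ≤ d → block a ≡ block (a + t)
  CutFree⇒block-≡ {a} h zero _ = cong block (sym (+-identityʳ a))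
  CutFree⇒block-≡ {a} h (suc t) p = trans (CutFree⇒block-≡ {a} h t (≤-trans (n≤1+n t) p)) (link h t p)

  CutFree-≤ : ∀ {a d d'} → d' ≤ d → CutFree a d → CutFree a d'
  CutFree-≤ le h = mkCutFree λ t p → link h t (≤-trans p le)

  CutFree-snoc : ∀ {a d} → CutFree a d → block (a + d) ≡ block (a + suc d) → CutFree a (suc d)
  CutFree-snoc {a} {d} h last = mkCutFree links
    where
    links : ∀ t → t < suc d → block (a + t) ≡ block (a + suc t)
    links t t≤d with m≤n⇒m<n∨m≡n (s≤s⁻¹ t≤d)
    ... | inj₁ t<d = link h t t<d
    ... | inj₂ refl = last

  CutFree-drop : ∀ {a} e d → CutFree a (e + d) → CutFree (a + e) d
  CutFree-drop {a} e d h = mkCutFree λ t t<d →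
    trans (cong block (+-assoc a e t))
          (trans (link h (e + t) (+-monoʳ-< e t<d)) (cong block (trans (cong (a +_) (sym (+-suc e t))) (sym (+-assoc a e (suc t))))))

  CutFree-transport : ∀ {a b d} → (∀ t → block (a + t) ≡ block (b + t)) → CutFree a d → CutFree b d
  CutFree-transport f h = mkCutFree λ t p → trans (sym (f t)) (trans (link h t p) (f (suc t)))

  CutFree-reduce : ∀ {a d} → CutFree a d → CutFree (toℕ (node a)) d
  CutFree-reduce {a} {d} = CutFree-transport {a} {toℕ (node a)} {d} (λ t → sym (block-reduce a t))

  CutFree-unreduce : ∀ {a d} → CutFree (toℕ (node a)) d → CutFree a d
  CutFree-unreduce {a} {d} = CutFree-transport {toℕ (node a)} {a} {d} (block-reduce a)

  CutFree-++ : ∀ {a} d e → CutFree a d → CutFree (a + d) e → CutFree a (d + e)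
  CutFree-++ {a} d e h₁ h₂ = mkCutFree links
    where
    links : ∀ t → t < d + e → block (a + t) ≡ block (a + suc t)
    links t t<d+e with t <? d
    ... | yes t<d = link h₁ t t<d
    ... | no t≮d with m≤n⇒∃[o]m+o≡n (≮⇒≥ t≮d)
    ... | o , refl = trans (cong block (sym (+-assoc a d o)))
                           (trans (link h₂ o (+-cancelˡ-< d o e t<d+e)) (cong block (trans (+-assoc a d (suc o)) (cong (a +_) (+-suc d o)))))

  Arc : Fin k → Fin k → Set
  Arc i j = Σ ℕ λ d → (i ⊕ d ≡ j) × CutFree (toℕ i) d

  Conn : Fin k → Fin k → Set
  Conn i j = Arc i j ⊎ Arc j i

  edge-fwd : ∀ {l j : Fin k} → j ≡ l ⊕ 1 → Π l ≡ Π j → edge Π l j ≡ true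
  edge-fwd {l} {j} e p = ∧-intro (∨-introˡ _ _ (==-intro e)) (≡⇒≡ᵇ-true p)

  edge-bwd : ∀ {l j : Fin k} → l ≡ j ⊕ 1 → Π l ≡ Π j → edge Π l j ≡ true
  edge-bwd {l} {j} e p = ∧-intro (∨-introʳ (j == (l ⊕ 1)) _ (==-intro e)) (≡⇒≡ᵇ-true p)

  edge-elim : ∀ {l j : Fin k} → edge Π l j ≡ true → (j ≡ l ⊕ 1 ⊎ l ≡ j ⊕ 1) × Π l ≡ Π j
  edge-elim {l} {j} e with ∧-elim _ _ e
  ... | a , b with ∨-elim _ _ a
  ... | inj₁ p = inj₁ (==-elim p) , ≡ᵇ-true⇒≡ b
  ... | inj₂ p = inj₂ (==-elim p) , ≡ᵇ-true⇒≡ b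

  reach-≤ : ∀ {m m'} {i j : Fin k} → m ≤ m' → reach Π m i j ≡ true → reach Π m' i j ≡ true
  reach-≤ {m' = zero} z≤n r = r
  reach-≤ {m' = suc m'} m≤ r with m≤n⇒m<n∨m≡n m≤
  ... | inj₁ m<1+m' = ∨-introˡ _ _ (reach-≤ (s≤s⁻¹ m<1+m') r)
  ... | inj₂ refl = r

  reach-snoc : ∀ {m} {i l j : Fin k} → reach Π m i l ≡ true → edge Π l j ≡ true → reach Π (suc m) i j ≡ true
  reach-snoc {m} {i} {l} {j} r e = ∨-introʳ (reach Π m i j) _ (anyᶠ-intro (λ l → reach Π m i l ∧ edge Π l j) l (∧-intro r e))

  reach-forward : ∀ (i : Fin k) d → CutFree (toℕ i) d → ∀ t → t ≤ d → reach Π t i (i ⊕ t) ≡ true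
  reach-forward i d h zero _ = ==-intro (sym (⊕-identityʳ i))
  reach-forward i d h (suc t) t<d =
    reach-snoc {t} {i} (reach-forward i d h t (≤-trans (n≤1+n t) t<d)) (edge-fwd (⊕-suc i t) (link h t t<d))

  reach-backward : ∀ (j : Fin k) d → CutFree (toℕ j) d → ∀ t o → t + o ≡ d → reach Π t (j ⊕ d) (j ⊕ o) ≡ true
  reach-backward j d h zero o refl = ==-intro refl
  reach-backward j d h (suc t) o refl =
    reach-snoc {t} {j ⊕ (suc t + o)} (reach-backward j d h t (suc o) (+-suc t o)) (edge-bwd (⊕-suc j o) (sym (link h o (s≤s (m≤n+m o t)))))

  Arc⇒reach : ∀ {i j} → Arc i j → reach Π k i j ≡ true
  Arc⇒reach {i} {j} (d , i⊕d≡j , h) =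
    reach-≤ (<⇒≤ (m%n<n d k))
      (subst (λ v → reach Π (d % k) i v ≡ true) (trans (⊕-% i d) i⊕d≡j)
        (reach-forward i (d % k) (CutFree-≤ (m%n≤m d k) h) (d % k) ≤-refl))

  Arc⁻¹⇒reach : ∀ {i j} → Arc j i → reach Π k i j ≡ true
  Arc⁻¹⇒reach {i} {j} (d , j⊕d≡i , h) =
    reach-≤ (<⇒≤ (m%n<n d k))
      (subst₂ (λ u v → reach Π (d % k) u v ≡ true) (trans (⊕-% j d) j⊕d≡i) (⊕-identityʳ j)
        (reach-backward j (d % k) (CutFree-≤ (m%n≤m d k) h) (d % k) 0 (+-identityʳ _)))

  Conn⇒cycConn : ∀ {i j} → Conn i j → cycConn Π i j ≡ true
  Conn⇒cycConn (inj₁ arc) = Arc⇒reach arc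
  Conn⇒cycConn (inj₂ arc) = Arc⁻¹⇒reach arc

  CutFree-cons : ∀ a d → block (a + 0) ≡ block (a + 1) → CutFree (a + 1) d → CutFree a (suc d)
  CutFree-cons a d first h = mkCutFree links
    where
    shift : ∀ t → a + suc t ≡ a + 1 + t
    shift t = sym (+-assoc a 1 t)
    links : ∀ t → t < suc d → block (a + t) ≡ block (a + suc t)
    links zero _ = first
    links (suc t) (s≤s t<d) = trans (cong block (shift t)) (trans (link h t t<d) (cong block (sym (shift (suc t)))))

  block-⊕0 : ∀ (i : Fin k) → block (toℕ i + 0) ≡ Π i
  block-⊕0 i = cong Π (⊕-identityʳ i)

  Conn-step : ∀ {i l j} → Conn i l → (j ≡ l ⊕ 1 ⊎ l ≡ j ⊕ 1) → Π l ≡ Π j → Conn i j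
  Conn-step {i} {l} {j} (inj₁ (d , e , h)) (inj₁ j≡l+1) same =
    inj₁ (suc d , e' , CutFree-snoc {toℕ i} {d} h (trans (cong Π e) (trans same (sym (cong Π e')))))
    where
    e' : i ⊕ suc d ≡ j
    e' = trans (⊕-suc i d) (trans (cong (_⊕ 1) e) (sym j≡l+1))
  Conn-step {i} {l} {j} (inj₂ (zero , e , h)) (inj₁ j≡l+1) same =
    inj₁ (1 , e' , mkCutFree λ { zero _ → trans (block-⊕0 i) (trans (cong Π i≡l) (trans same (sym (cong Π e')))) ; (suc t) (s≤s ()) })
    where
    i≡l : i ≡ l
    i≡l = trans (sym e) (⊕-identityʳ l)
    e' : i ⊕ 1 ≡ j
    e' = trans (cong (_⊕ 1) i≡l) (sym j≡l+1)
  Conn-step {i} {l} {j} (inj₂ (suc d , e , h)) (inj₁ j≡l+1) same =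
    inj₂ (d , trans (cong (_⊕ d) j≡l+1) (trans (⊕-assoc l 1 d) e) ,
          subst (λ v → CutFree (toℕ v) d) (sym j≡l+1) (CutFree-reduce {toℕ l + 1} {d} (CutFree-drop {toℕ l} 1 d h)))
  Conn-step {i} {l} {j} (inj₁ (zero , e , h)) (inj₂ l≡j+1) same =
    inj₂ (1 , sym (trans (sym (⊕-identityʳ i)) (trans e l≡j+1)) ,
          mkCutFree λ { zero _ → trans (block-⊕0 j) (trans (sym same) (cong Π l≡j+1)) ; (suc t) (s≤s ()) })
  Conn-step {i} {l} {j} (inj₁ (suc d , e , h)) (inj₂ l≡j+1) same =
    inj₁ (d , ⊕-cancelʳ (i ⊕ d) j 1 (trans (sym (⊕-suc i d)) (trans e l≡j+1)) , CutFree-≤ (n≤1+n d) h)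
  Conn-step {i} {l} {j} (inj₂ (d , e , h)) (inj₂ l≡j+1) same =
    inj₂ (suc d , trans (sym (⊕-assoc j 1 d)) (trans (cong (_⊕ d) (sym l≡j+1)) e) ,
          CutFree-cons (toℕ j) d (trans (block-⊕0 j) (trans (sym same) (cong Π l≡j+1)))
                                 (CutFree-unreduce {toℕ j + 1} {d} (subst (λ v → CutFree (toℕ v) d) l≡j+1 h)))

  reach⇒Conn : ∀ m {i j} → reach Π m i j ≡ true → Conn i j
  reach⇒Conn zero {i} {j} r = inj₁ (0 , trans (⊕-identityʳ i) (==-elim r) , mkCutFree (λ t ()))
  reach⇒Conn (suc m) {i} {j} r with ∨-elim _ _ r
  ... | inj₁ r′ = reach⇒Conn m r′
  ... | inj₂ via with anyᶠ-elim (λ l → reach Π m i l ∧ edge Π l j) via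
  ... | l , r∧e with ∧-elim _ _ r∧e
  ... | r′ , e with edge-elim e
  ... | adjacent , same = Conn-step (reach⇒Conn m r′) adjacent same

  cycConn⇒Conn : ∀ {i j} → cycConn Π i j ≡ true → Conn i j
  cycConn⇒Conn = reach⇒Conn k

  ¬Conn⇒cycConn-false : ∀ {i j} → ¬ Conn i j → cycConn Π i j ≡ false
  ¬Conn⇒cycConn-false {i} {j} ne with cycConn Π i j in e
  ... | false = refl
  ... | true = ⊥-elim (ne (cycConn⇒Conn e))

  #cuts : ℕ
  #cuts = ∑ k cut

  -- Node 0 is the least node of its cyclic component; node m + 1 is one iff there are cuts at m
  -- and at some position among m + 1, …, k − 1, since otherwise its component runs on through 0.
  isLeader : ℕ → Bool
  isLeader zero = true
  isLeader (suc m) = isCut m ∧ any< (n ∸ m) (λ s → isCut (suc m + s))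

  earlierConn : Fin k → Fin k → Bool
  earlierConn i j = ⌊ toℕ j <? toℕ i ⌋ ∧ cycConn Π i j

  private
    module _ (i : Fin k) (m : ℕ) (i≡1+m : toℕ i ≡ suc m) where

      m<n : m < n
      m<n = s≤s⁻¹ (subst (_< k) i≡1+m (toℕ<n i))

      earlier : ∀ j → toℕ j ≤ m → Conn i j → anyᶠ (earlierConn i) ≡ true
      earlier j j≤m c = anyᶠ-intro (earlierConn i) j
                          (∧-intro (<ᵇ-true (toℕ j) (toℕ i) (subst (toℕ j <_) (sym i≡1+m) (s≤s j≤m))) (Conn⇒cycConn c))

      joined-to-predecessor : isCut m ≡ false → anyᶠ (earlierConn i) ≡ true
      joined-to-predecessor no-cut = earlier (node m) (≤-reflexive m′≡m) (inj₂ (1 , step , one-link))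
        where
        m′≡m : toℕ (node m) ≡ m
        m′≡m = toℕ-node-< m (<-trans m<n (n<1+n n))
        step : node m ⊕ 1 ≡ i
        step = trans (node-reduce m 1) (trans (cong node (+-comm m 1)) (trans (cong node (sym i≡1+m)) (node-toℕ i)))
        one-link : CutFree (toℕ (node m)) 1
        one-link = mkCutFree λ
          { zero _ → subst (λ v → block (v + 0) ≡ block (v + 1)) (sym m′≡m)
                       (trans (cong block (+-identityʳ m)) (trans (isCut-false⇒≡ no-cut) (cong block (+-comm 1 m))))
          ; (suc t) (s≤s ()) }

      joined-through-0 : any< (n ∸ m) (λ s → isCut (suc m + s)) ≡ false → anyᶠ (earlierConn i) ≡ true
      joined-through-0 no-cut = earlier F.zero z≤n (inj₁ (n ∸ m , to-0 , to-0-free))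
        where
        to-0 : i ⊕ (n ∸ m) ≡ F.zero
        to-0 = trans (cong (λ v → node (v + (n ∸ m))) i≡1+m)
                 (trans (cong (node ∘ suc) (m+[n∸m]≡n (<⇒≤ m<n))) (trans (cong node (sym (+-identityʳ k))) (node-k+ 0)))
        to-0-free : CutFree (toℕ i) (n ∸ m)
        to-0-free = subst (λ v → CutFree v (n ∸ m)) (sym i≡1+m) (isCut-false⇒CutFree (any<-false-elim (n ∸ m) _ no-cut))

      separated-from-earlier : isCut m ≡ true → any< (n ∸ m) (λ s → isCut (suc m + s)) ≡ true →
                               anyᶠ (earlierConn i) ≡ false
      separated-from-earlier cut-before cut-after = anyᶠ-false (earlierConn i) not-earlier
        where
        later-cut = any<-elim (n ∸ m) (λ s → isCut (suc m + s)) cut-after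
        s = proj₁ later-cut
        s<n∸m = proj₁ (proj₂ later-cut)
        cut-s = proj₂ (proj₂ later-cut)
        apart : ∀ j → toℕ j < suc m → ¬ Conn i j
        apart j j<i (inj₁ (d , i⊕d≡j , h)) with s <? d
        ... | yes s<d = contradictionᵇ cut-s (subst (λ v → isCut (v + s) ≡ false) i≡1+m (CutFree⇒isCut-false h s s<d))
        ... | no s≮d = <⇒≱ j<i (subst (suc m ≤_) lands (m≤m+n (suc m) d))
          where
          no-wrap : suc m + d < k
          no-wrap = ≤-trans (s≤s (+-monoʳ-≤ (suc m) (≮⇒≥ s≮d)))
                      (≤-trans (+-monoʳ-< (suc m) s<n∸m) (≤-reflexive (cong suc (m+[n∸m]≡n (<⇒≤ m<n)))))
          lands : suc m + d ≡ toℕ j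
          lands = trans (sym (toℕ-node-< (suc m + d) no-wrap)) (trans (cong (λ v → toℕ (node (v + d))) (sym i≡1+m)) (cong toℕ i⊕d≡j))
        apart j j<i (inj₂ (d , j⊕d≡i , h)) with (m ∸ toℕ j) <? d
        ... | yes gap<d = contradictionᵇ cut-before
                            (subst (λ v → isCut v ≡ false) (m+[n∸m]≡n (s≤s⁻¹ j<i)) (CutFree⇒isCut-false h (m ∸ toℕ j) gap<d))
        ... | no gap≮d = <⇒≢ short (trans (sym (toℕ-node-< (toℕ j + d) (≤-trans short (<⇒≤ (subst (_< k) i≡1+m (toℕ<n i))))))
                                          (trans (cong toℕ j⊕d≡i) i≡1+m))
          where
          short : toℕ j + d < suc m
          short = s≤s (≤-trans (+-monoʳ-≤ (toℕ j) (≮⇒≥ gap≮d)) (≤-reflexive (m+[n∸m]≡n (s≤s⁻¹ j<i))))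
        not-earlier : ∀ j → earlierConn i j ≡ false
        not-earlier j with toℕ j <? toℕ i
        ... | no _ = refl
        ... | yes j<i = ¬Conn⇒cycConn-false (apart j (subst (toℕ j <_) i≡1+m j<i))

    isLeader-correct′ : ∀ i m → toℕ i ≡ m → not (anyᶠ (earlierConn i)) ≡ isLeader m
    isLeader-correct′ i zero i≡0 = not-false (anyᶠ-false (earlierConn i) λ j →
      cong (_∧ cycConn Π i j) (<ᵇ-false (toℕ j) (toℕ i) (λ j<i → n≮0 (subst (toℕ j <_) i≡0 j<i))))
    isLeader-correct′ i (suc m) i≡1+m with isCut m in cut-before
    ... | false = not-true (joined-to-predecessor i m i≡1+m cut-before)
    ... | true with any< (n ∸ m) (λ s → isCut (suc m + s)) in cut-after
    ... | false = not-true (joined-through-0 i m i≡1+m cut-after)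
    ... | true = not-false (separated-from-earlier i m i≡1+m cut-before cut-after)

  isLeader-correct : ∀ i → not (anyᶠ (earlierConn i)) ≡ isLeader (toℕ i)
  isLeader-correct i = isLeader-correct′ i (toℕ i) refl

  numCyc≡∑isLeader : numCyc Π ≡ ∑ k (ind ∘ isLeader)
  numCyc≡∑isLeader = sumℕ≡∑ _ (ind ∘ isLeader) (λ i → (cong ind (isLeader-correct i)))

  numCyc≡suc[#cuts∸1] : numCyc Π ≡ suc (#cuts ∸ 1)
  numCyc≡suc[#cuts∸1] = begin
    numCyc Π                          ≡⟨ numCyc≡∑isLeader ⟩
    suc (∑ n later)                   ≡⟨ cong suc (+-identityʳ _) ⟨
    suc (∑ n later + 0)               ≡⟨ cong (λ z → suc (∑ n later + z)) last-is-not-later ⟨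
    suc (∑ n later + later n)         ≡⟨ cong suc (∑-snoc n later) ⟨
    suc (∑ k later)                   ≡⟨ cong suc (count<-nonlast k isCut) ⟩
    suc (#cuts ∸ 1)                   ∎
    where
    open ≡-Reasoning
    later : ℕ → ℕ
    later t = ind (isCut t ∧ any< (k ∸ suc t) (λ s → isCut (suc t + s)))
    last-is-not-later : later n ≡ 0
    last-is-not-later = cong ind (trans (cong (λ v → isCut n ∧ any< v (λ s → isCut (suc n + s))) (n∸n≡0 n)) (∧-zeroʳ (isCut n)))

  cycSize-rotate : ∀ i a → cycSize Π i ≡ ∑ k (λ t → ind (cycConn Π i (node (a + t))))
  cycSize-rotate i a = trans (sumℕ≡∑ _ F (λ j → cong (ind ∘ cycConn Π i) (sym (node-toℕ j))))
                             (sym (∑-rotate k F a (λ m → cong (ind ∘ cycConn Π i) (node-k+ m))))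
    where
    F : ℕ → ℕ
    F m = ind (cycConn Π i (node m))

  CutFree⇒Arc : ∀ {a L} → CutFree a L → ∀ t u → t ≤ u → u ≤ L → Arc (node (a + t)) (node (a + u))
  CutFree⇒Arc {a} {L} h t u t≤u u≤L with m≤n⇒∃[o]m+o≡n t≤u
  ... | o , refl = o , trans (⊕-node (a + t) o) (cong node (+-assoc a t o)) ,
                   CutFree-reduce {a + t} {o} (CutFree-drop t o (CutFree-≤ u≤L h))

  CutFree⇒Conn : ∀ {a L} → CutFree a L → ∀ t u → t ≤ L → u ≤ L → Conn (node (a + t)) (node (a + u))
  CutFree⇒Conn h t u t≤L u≤L with ≤-total t u
  ... | inj₁ t≤u = inj₁ (CutFree⇒Arc h t u t≤u u≤L)
  ... | inj₂ u≤t = inj₂ (CutFree⇒Arc h u t u≤t t≤L)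

  run≤cycSize : ∀ a L e → CutFree a L → L < k → e ≤ L → suc L ≤ cycSize Π (node (a + e))
  run≤cycSize a L e h L<k e≤L = subst (suc L ≤_) (sym (cycSize-rotate (node (a + e)) a)) (begin
    suc L            ≡⟨ *-identityʳ (suc L) ⟨
    suc L * 1        ≤⟨ ∑-≥-const (suc L) G 1 connected ⟩
    ∑ (suc L) G      ≤⟨ ∑-prefix-≤ (suc L) k G L<k ⟩
    ∑ k G            ∎)
    where
    open ≤-Reasoning
    G : ℕ → ℕ
    G t = ind (cycConn Π (node (a + e)) (node (a + t)))
    connected : ∀ t → t < suc L → 1 ≤ G t
    connected t t≤L = ≤-reflexive (sym (cong ind (Conn⇒cycConn (CutFree⇒Conn h e t e≤L (s≤s⁻¹ t≤L)))))

  cuts-separate : ∀ α d e t → isCut α ≡ true → isCut (suc α + d) ≡ true → e ≤ d → d < t → t < k →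
                  ¬ Conn (node (suc α + e)) (node (suc α + t))
  cuts-separate α d e t _ cut-end e≤d d<t t<k (inj₁ (x , lands , h))
    with m≤n⇒∃[o]m+o≡n e≤d | m≤n⇒∃[o]m+o≡n (≤-trans e≤d (<⇒≤ d<t))
  ... | to-end , refl | to-t , refl =
    contradictionᵇ cut-end (subst (λ v → isCut v ≡ false) (+-assoc (suc α) e to-end)
                             (CutFree⇒isCut-false (CutFree-unreduce {suc α + e} {x} h) to-end crosses))
    where
    to-t≤x : to-t ≤ x
    to-t≤x = node-≡⇒residue≤ (suc α + e) x to-t
               (trans (sym (⊕-node (suc α + e) x)) (trans lands (cong node (sym (+-assoc (suc α) e to-t)))))
               (≤-trans (s≤s (m≤n+m to-t e)) t<k)
    crosses : to-end < x
    crosses = ≤-trans (+-cancelˡ-≤ e (suc to-end) to-t (≤-trans (≤-reflexive (+-suc e to-end)) d<t)) to-t≤x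
  cuts-separate α d e t cut-start _ e≤d d<t t<k (inj₂ (x , lands , h)) with m≤n⇒∃[o]m+o≡n t<k
  ... | to-k , 1+t+to-k≡k =
    contradictionᵇ cut-start (trans (sym (isCut-k+ α)) (subst (λ v → isCut v ≡ false) wraps
                               (CutFree⇒isCut-false (CutFree-unreduce {suc α + t} {x} h) to-k to-k<x)))
    where
    regroup₁ : ∀ a t o e → a + t + (suc o + e) ≡ suc t + o + (a + e)
    regroup₁ = solve-∀
    regroup₂ : ∀ a t o → suc a + t + o ≡ suc t + o + a
    regroup₂ = solve-∀
    back : ℕ
    back = suc to-k + e
    back-lands : suc α + t + back ≡ k + (suc α + e)
    back-lands = trans (regroup₁ (suc α) t to-k e) (cong (_+ (suc α + e)) 1+t+to-k≡k)
    back<k : back < k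
    back<k = subst (back <_) 1+t+to-k≡k
               (s≤s (subst (_≤ t + to-k) (cong suc (+-comm e to-k)) (+-monoˡ-≤ to-k (<-≤-trans (s≤s e≤d) d<t))))
    back≤x : back ≤ x
    back≤x = node-≡⇒residue≤ (suc α + t) x back
               (trans (sym (⊕-node (suc α + t) x)) (trans lands (trans (sym (node-k+ (suc α + e))) (cong node (sym back-lands)))))
               back<k
    to-k<x : to-k < x
    to-k<x = ≤-trans (s≤s (m≤m+n to-k e)) back≤x
    wraps : suc α + t + to-k ≡ k + α
    wraps = trans (regroup₂ α t to-k) (cong (_+ α) 1+t+to-k≡k)

  cycSize≤run : ∀ α d e → isCut α ≡ true → isCut (suc α + d) ≡ true → e ≤ d → cycSize Π (node (suc α + e)) ≤ suc d
  cycSize≤run α d e cut-start cut-end e≤d = subst (_≤ suc d) (sym (cycSize-rotate (node (suc α + e)) (suc α)))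
    (∑-≤-support k (suc d) _ (λ t d<t t<k → cong ind (¬Conn⇒cycConn-false (cuts-separate α d e t cut-start cut-end e≤d d<t t<k)))
                  (λ t _ → ind≤1 _))

  cuts-enclose : ∀ α d e j → isCut α ≡ true → isCut (suc α + d) ≡ true → e ≤ d → Conn (node (suc α + e)) j →
                 Σ ℕ λ t → t ≤ d × node (suc α + t) ≡ j
  cuts-enclose α d e j cut-start cut-end e≤d c with node-offset (suc α) j
  ... | t , t<k , at with suc d ≤? t
  ... | yes d<t = ⊥-elim (cuts-separate α d e t cut-start cut-end e≤d d<t t<k (subst (Conn (node (suc α + e))) (sym at) c))
  ... | no d≮t = t , s≤s⁻¹ (≰⇒> d≮t) , at

  record Run (p : ℕ) : Set where
    field
      α e d : ℕ
      e≤d : e ≤ d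
      d<k : d < k
      cut-start : isCut α ≡ true
      cut-end : isCut (suc α + d) ≡ true
      free : CutFree (suc α) d
      pos : node (suc α + e) ≡ node p

  #cuts-rotate : ∀ p → count< k (λ u → isCut (p + u)) ≡ #cuts
  #cuts-rotate p = ∑-rotate k cut p cut-periodic

  isCut-+k : ∀ a → isCut (a + k) ≡ isCut a
  isCut-+k a = trans (cong isCut (+-comm a k)) (isCut-k+ a)

  -- The run through p starts after the last cut among p, …, p + k − 1 and ends at the first one.
  opaque
    run : ∀ p → 1 ≤ #cuts → Run p
    run p 1≤#cuts with last< k (λ u → isCut (p + u)) some-cut | first< k (λ u → isCut (p + u)) some-cut
      where
      some-cut : any< k (λ u → isCut (p + u)) ≡ true
      some-cut = 1≤count<⇒any< k (λ u → isCut (p + u)) (subst (1 ≤_) (sym (#cuts-rotate p)) 1≤#cuts)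
    ... | lst , lst<k , cut-lst , none-after | fst , fst<k , cut-fst , none-before with m≤n⇒∃[o]m+o≡n (s≤s⁻¹ lst<k)
    ... | gap , lst+gap≡n = record
      { α = p + lst ; e = gap ; d = gap + fst ; e≤d = m≤m+n gap fst ; d<k = d<k
      ; cut-start = cut-lst ; cut-end = cut-end ; free = isCut-false⇒CutFree free ; pos = pos }
      where
      fst≤lst : fst ≤ lst
      fst≤lst with fst ≤? lst
      ... | yes fst≤lst = fst≤lst
      ... | no fst≰lst = contradictionᵇ cut-fst (none-after fst (≰⇒> fst≰lst) fst<k)
      wraps : suc (p + lst) + gap ≡ p + k
      wraps = trans (cong suc (+-assoc p lst gap)) (trans (sym (+-suc p (lst + gap))) (cong (λ z → p + suc z) lst+gap≡n))
      d<k : gap + fst < k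
      d<k = s≤s (≤-trans (+-monoʳ-≤ gap fst≤lst) (≤-reflexive (trans (+-comm gap lst) lst+gap≡n)))
      wrapped : ∀ w → suc (p + lst) + (gap + w) ≡ (p + w) + k
      wrapped w = begin
        suc (p + lst) + (gap + w)   ≡⟨ +-assoc (suc (p + lst)) gap w ⟨
        suc (p + lst) + gap + w     ≡⟨ cong (_+ w) wraps ⟩
        p + k + w                   ≡⟨ regroup p k w ⟩
        p + w + k                   ∎
        where
        open ≡-Reasoning
        regroup : ∀ p k w → p + k + w ≡ p + w + k
        regroup = solve-∀
      cut-end : isCut (suc (p + lst) + (gap + fst)) ≡ true
      cut-end = trans (cong isCut (wrapped fst)) (trans (isCut-+k (p + fst)) cut-fst)
      free : ∀ t → t < gap + fst → isCut (suc (p + lst) + t) ≡ false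
      free t t<d with t <? gap
      ... | yes t<gap = trans (cong isCut (trans (cong suc (+-assoc p lst t)) (sym (+-suc p (lst + t)))))
                              (none-after (suc (lst + t)) (s≤s (m≤m+n lst t))
                                          (subst (suc (lst + t) <_) (cong suc lst+gap≡n) (s≤s (+-monoʳ-< lst t<gap))))
      ... | no t≮gap with m≤n⇒∃[o]m+o≡n (≮⇒≥ t≮gap)
      ... | w , refl = trans (cong isCut (wrapped w)) (trans (isCut-+k (p + w)) (none-before w (+-cancelˡ-< gap w fst t<d)))
      pos : node (suc (p + lst) + gap) ≡ node p
      pos = trans (cong node (trans wraps (+-comm p k))) (node-k+ p)

  cycSize-run : ∀ {p} (r : Run p) → ∀ t → t ≤ Run.d r → cycSize Π (node (suc (Run.α r) + t)) ≡ suc (Run.d r)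
  cycSize-run r t t≤d = ≤-antisym (cycSize≤run α d t cut-start cut-end t≤d) (run≤cycSize (suc α) d t free d<k t≤d)
    where open Run r

  cycSize-run-start : ∀ {p} (r : Run p) → cycSize Π (node p) ≡ suc (Run.d r)
  cycSize-run-start r = trans (cong (cycSize Π) (sym (Run.pos r))) (cycSize-run r (Run.e r) (Run.e≤d r))

  cycSize-Conn-run : ∀ {p} (r : Run p) v → Conn (node p) v → cycSize Π v ≡ suc (Run.d r)
  cycSize-Conn-run r v c with cuts-enclose α d e v cut-start cut-end e≤d (subst (λ z → Conn z v) (sym pos) c)
    where open Run r
  ... | t , t≤d , at = trans (cong (cycSize Π) (sym at)) (cycSize-run r t t≤d)

  Conn⇒cycSize-≡ : 1 ≤ #cuts → ∀ u v → Conn u v → cycSize Π v ≡ cycSize Π u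
  Conn⇒cycSize-≡ 1≤#cuts u v c = begin
    cycSize Π v               ≡⟨ cycSize-Conn-run r v (subst (λ z → Conn z v) (sym (node-toℕ u)) c) ⟩
    suc (Run.d r)             ≡⟨ cycSize-run-start r ⟨
    cycSize Π (node (toℕ u))  ≡⟨ cong (cycSize Π) (node-toℕ u) ⟩
    cycSize Π u               ∎
    where
    open ≡-Reasoning
    r = run (toℕ u) 1≤#cuts

  numCyc≡#cuts : 1 ≤ #cuts → numCyc Π ≡ #cuts
  numCyc≡#cuts 1≤#cuts = trans numCyc≡suc[#cuts∸1] (m+[n∸m]≡n 1≤#cuts)

  numCyc≡1 : #cuts ≡ 0 → numCyc Π ≡ 1
  numCyc≡1 no-cuts = trans numCyc≡suc[#cuts∸1] (cong (λ z → suc (z ∸ 1)) no-cuts)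

  block-node-≡ : ∀ a b → node a ≡ node b → ∀ t → block (a + t) ≡ block (b + t)
  block-node-≡ a b e t = trans (sym (block-reduce a t)) (trans (cong (λ z → block (toℕ z + t)) e) (block-reduce b t))

  isCut-node-≡ : ∀ a b → node a ≡ node b → ∀ t → isCut (a + t) ≡ isCut (b + t)
  isCut-node-≡ a b e t = cong₂ (λ u v → not (u ≡ᵇ v)) (block-node-≡ a b e t)
    (trans (cong block (sym (+-suc a t))) (trans (block-node-≡ a b e (suc t)) (cong block (+-suc b t))))

  CutFree-node-≡ : ∀ {a b d} → node a ≡ node b → CutFree a d → CutFree b d
  CutFree-node-≡ {a} {b} {d} e = CutFree-transport {a} {b} {d} (block-node-≡ a b e)

  #cuts≡0⇒¬isCut : #cuts ≡ 0 → ∀ a → isCut a ≡ false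
  #cuts≡0⇒¬isCut no-cuts a = begin
    isCut a                      ≡⟨ cong isCut (+-identityʳ a) ⟨
    isCut (a + 0)                ≡⟨ isCut-node-≡ a (toℕ (node a)) (sym (node-node a)) 0 ⟩
    isCut (toℕ (node a) + 0)     ≡⟨ cong isCut (+-identityʳ _) ⟩
    isCut (toℕ (node a))         ≡⟨ count<≡0⇒none k isCut no-cuts (toℕ (node a)) (toℕ<n (node a)) ⟩
    false                        ∎
    where open ≡-Reasoning

  Conn-sym : ∀ {i j} → Conn i j → Conn j i
  Conn-sym (inj₁ arc) = inj₂ arc
  Conn-sym (inj₂ arc) = inj₁ arc

module Windows (n : ℕ) (Π : Partition (suc n)) (q : ℕ) where

  open Cycle n
  open Blocks n Π

  join₁ joinq split : ℕ → ℕ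
  join₁ m = ind (block m ≡ᵇ block (m + 1))
  joinq m = ind (block m ≡ᵇ block (m + q))
  split m = ind (not (block m ≡ᵇ block (m + q)))

  #splits : ℕ
  #splits = ∑ k split

  windowCuts : ℕ → ℕ
  windowCuts m = count< q (λ t → isCut (m + t))

  private
    ind+ind-not : ∀ b → ind b + ind (not b) ≡ 1
    ind+ind-not true = refl
    ind+ind-not false = refl

    ∑-complement : ∀ (b : ℕ → Bool) → ∑ k (λ m → ind (b m)) + ∑ k (λ m → ind (not (b m))) ≡ k
    ∑-complement b = begin
      ∑ k (λ m → ind (b m)) + ∑ k (λ m → ind (not (b m)))  ≡⟨ ∑-distrib-+ k (λ m → ind (b m)) (λ m → ind (not (b m))) ⟨
      ∑ k (λ m → ind (b m) + ind (not (b m)))              ≡⟨ ∑-cong k (λ m _ → ind+ind-not (b m)) ⟩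
      ∑ k (λ _ → 1)                                        ≡⟨ ∑-const k 1 ⟩
      k * 1                                                ≡⟨ *-identityʳ k ⟩
      k                                                    ∎
      where open ≡-Reasoning

    lhs≡joins : lhs Π q ≡ ℤ.+ ∑ k join₁ ℤ.- ℤ.+ ∑ k joinq
    lhs≡joins = trans (sumℤ≡∑ℤ _ (λ m → ℤ.+ join₁ m ℤ.- ℤ.+ joinq m) termwise) (∑ℤ-split k join₁ joinq)
      where
      termwise : ∀ i → ℤ.+ x Π i (i ⊕ 1) ℤ.- ℤ.+ x Π i (i ⊕ q) ≡ ℤ.+ join₁ (toℕ i) ℤ.- ℤ.+ joinq (toℕ i)
      termwise i = cong₂ (λ u v → ℤ.+ u ℤ.- ℤ.+ v)
                     (cong (λ z → ind (z ≡ᵇ block (toℕ i + 1))) (sym (block-toℕ i)))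
                     (cong (λ z → ind (z ≡ᵇ block (toℕ i + q))) (sym (block-toℕ i)))

    joins₁+#cuts≡k : ∑ k join₁ + #cuts ≡ k
    joins₁+#cuts≡k = trans (cong (_+ #cuts) (∑-cong k (λ m _ → cong (λ z → ind (block m ≡ᵇ block z)) (+-comm m 1))))
                           (∑-complement (λ m → block m ≡ᵇ block (suc m)))

  lhs≡#splits-#cuts : lhs Π q ≡ ℤ.+ #splits ℤ.- ℤ.+ #cuts
  lhs≡#splits-#cuts = begin
    lhs Π q                                     ≡⟨ lhs≡joins ⟩
    ℤ.+ A ℤ.- ℤ.+ B                             ≡⟨ difference (ℤ.+ A) (ℤ.+ B) (ℤ.+ #cuts) (ℤ.+ #splits) ⟩
    (ℤ.+ A ℤ.+ ℤ.+ #cuts) ℤ.- (ℤ.+ B ℤ.+ ℤ.+ #splits) ℤ.+ (ℤ.+ #splits ℤ.- ℤ.+ #cuts)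
        ≡⟨ cong₂ (λ u v → u ℤ.- v ℤ.+ (ℤ.+ #splits ℤ.- ℤ.+ #cuts))
                 (trans (sym (ℤP.pos-+ A #cuts)) (cong ℤ.+_ joins₁+#cuts≡k))
                 (trans (sym (ℤP.pos-+ B #splits)) (cong ℤ.+_ (∑-complement (λ m → block m ≡ᵇ block (m + q))))) ⟩
    ℤ.+ k ℤ.- ℤ.+ k ℤ.+ (ℤ.+ #splits ℤ.- ℤ.+ #cuts)  ≡⟨ cancel (ℤ.+ k) (ℤ.+ #splits ℤ.- ℤ.+ #cuts) ⟩
    ℤ.+ #splits ℤ.- ℤ.+ #cuts                   ∎
    where
    open ≡-Reasoning
    A = ∑ k join₁
    B = ∑ k joinq
    difference : ∀ a b c z → a ℤ.- b ≡ (a ℤ.+ c) ℤ.- (b ℤ.+ z) ℤ.+ (z ℤ.- c)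
    difference = ℤSolver.solve-∀
    cancel : ∀ m d → m ℤ.- m ℤ.+ d ≡ d
    cancel = ℤSolver.solve-∀

  #splits≤k : #splits ≤ k
  #splits≤k = subst (#splits ≤_) (trans (∑-const k 1) (*-identityʳ k)) (∑-mono-≤ k {split} (λ m _ → ind≤1 _))

  windowCuts≡0⇒CutFree : ∀ m → windowCuts m ≡ 0 → CutFree m q
  windowCuts≡0⇒CutFree m e = isCut-false⇒CutFree (count<≡0⇒none q _ e)

  block-≡⇒split≡0 : ∀ m → block m ≡ block (m + q) → split m ≡ 0
  block-≡⇒split≡0 m same rewrite ≡⇒≡ᵇ-true same = refl

  CutFree⇒split≡0 : ∀ m → CutFree m q → split m ≡ 0
  CutFree⇒split≡0 m h = block-≡⇒split≡0 m (CutFree⇒block-≡ h q ≤-refl)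

  CutFree⇒windowCuts≡0 : ∀ m → CutFree m q → windowCuts m ≡ 0
  CutFree⇒windowCuts≡0 m h = count<-none q _ (any<-false-intro q _ (CutFree⇒isCut-false h))

  windowCuts-node-≡ : ∀ a b → node a ≡ node b → windowCuts a ≡ windowCuts b
  windowCuts-node-≡ a b e = ∑-cong q (λ t _ → cong ind (isCut-node-≡ a b e t))

  split≤windowCuts : ∀ m → split m ≤ windowCuts m
  split≤windowCuts m with windowCuts m in e
  ... | zero = ≤-reflexive (CutFree⇒split≡0 m (windowCuts≡0⇒CutFree m e))
  ... | suc w = ≤-trans (ind≤1 _) (s≤s z≤n)

  ∑windowCuts≡q*#cuts : ∑ k windowCuts ≡ q * #cuts
  ∑windowCuts≡q*#cuts = begin
    ∑ k (λ m → ∑ q (λ t → cut (m + t)))   ≡⟨ ∑-comm k q (λ m t → cut (m + t)) ⟩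
    ∑ q (λ t → ∑ k (λ m → cut (m + t)))   ≡⟨ ∑-cong q (λ t _ → rotated t) ⟩
    ∑ q (λ _ → #cuts)                     ≡⟨ ∑-const q #cuts ⟩
    q * #cuts                             ∎
    where
    open ≡-Reasoning
    rotated : ∀ t → ∑ k (λ m → cut (m + t)) ≡ #cuts
    rotated t = trans (∑-cong k (λ m _ → cong cut (+-comm m t))) (∑-rotate k cut t cut-periodic)

  #splits≤q*#cuts : #splits ≤ q * #cuts
  #splits≤q*#cuts = subst (#splits ≤_) ∑windowCuts≡q*#cuts (∑-mono-≤ k (λ m _ → split≤windowCuts m))

  windowCuts≡1⇒split≡1 : ∀ m → windowCuts m ≡ 1 → split m ≡ 1
  windowCuts≡1⇒split≡1 m one-cut with any<-elim q _ (1≤count<⇒any< q (λ t → isCut (m + t)) (≤-reflexive (sym one-cut)))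
  ... | t , t<q , cut-at-t = cong ind (not-false (≢⇒≡ᵇ-false different))
    where
    no-other-cut : ∀ s → s < q → s ≢ t → isCut (m + s) ≡ false
    no-other-cut s s<q s≢t = count<≤1⇒unique q (λ t → isCut (m + t)) (≤-reflexive one-cut) t t<q cut-at-t s s<q s≢t
    before : block m ≡ block (m + t)
    before = CutFree⇒block-≡ (isCut-false⇒CutFree (λ s s<t → no-other-cut s (<-trans s<t t<q) (<⇒≢ s<t))) t ≤-refl
    after-free : CutFree (m + suc t) (q ∸ suc t)
    after-free = isCut-false⇒CutFree λ s s<rest →
      trans (cong isCut (+-assoc m (suc t) s))
            (no-other-cut (suc t + s) (subst (suc t + s <_) (m+[n∸m]≡n t<q) (+-monoʳ-< (suc t) s<rest))
                          (λ e → <⇒≢ (m≤m+n (suc t) s) (sym e)))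
    after : block (m + suc t) ≡ block (m + q)
    after = trans (CutFree⇒block-≡ after-free (q ∸ suc t) ≤-refl)
                  (cong block (trans (+-assoc m (suc t) (q ∸ suc t)) (cong (m +_) (m+[n∸m]≡n t<q))))
    different : block m ≢ block (m + q)
    different same = isCut-true⇒≢ cut-at-t (trans (sym before) (trans same (trans (sym after) (cong block (+-suc m t)))))

  windowCuts≤1⇒split≡windowCuts : ∀ m → windowCuts m ≤ 1 → split m ≡ windowCuts m
  windowCuts≤1⇒split≡windowCuts m ≤1 with windowCuts m in cuts
  ... | zero = n≤0⇒n≡0 (subst (split m ≤_) cuts (split≤windowCuts m))
  ... | suc zero = windowCuts≡1⇒split≡1 m cuts
  ... | suc (suc _) with ≤1
  ... | s≤s ()

  emptyWindow : ℕ → Bool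
  emptyWindow m = windowCuts m ≡ᵇ 0

  #emptyWindows : ℕ
  #emptyWindows = count< k emptyWindow

  emptyWindow-periodic : Periodic k (ind ∘ emptyWindow)
  emptyWindow-periodic m = cong (λ z → ind (z ≡ᵇ 0)) (windowCuts-node-≡ (k + m) m (node-k+ m))

  windowCuts≤1⇒q*#cuts+#emptyWindows≡k : (∀ m → windowCuts m ≤ 1) → q * #cuts + #emptyWindows ≡ k
  windowCuts≤1⇒q*#cuts+#emptyWindows≡k ≤1 = begin
    q * #cuts + #emptyWindows                       ≡⟨ cong (_+ #emptyWindows) ∑windowCuts≡q*#cuts ⟨
    ∑ k windowCuts + #emptyWindows                  ≡⟨ ∑-distrib-+ k windowCuts (ind ∘ emptyWindow) ⟨
    ∑ k (λ m → windowCuts m + ind (emptyWindow m))  ≡⟨ ∑-cong k (λ m _ → exactly-one m (≤1 m)) ⟩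
    ∑ k (λ _ → 1)                                   ≡⟨ ∑-const k 1 ⟩
    k * 1                                           ≡⟨ *-identityʳ k ⟩
    k                                               ∎
    where
    open ≡-Reasoning
    exactly-one : ∀ m → windowCuts m ≤ 1 → windowCuts m + ind (emptyWindow m) ≡ 1
    exactly-one m ≤1 with windowCuts m
    ... | zero = refl
    ... | suc zero = refl
    ... | suc (suc _) with ≤1
    ... | s≤s ()

  two-emptyWindows : ∀ a t → 0 < t → t < k → emptyWindow a ≡ true → emptyWindow (a + t) ≡ true → 2 ≤ #emptyWindows
  two-emptyWindows a t 0<t t<k empty-a empty-a+t =
    ≤-trans (2≤∑ k (λ s → ind (emptyWindow (a + s))) 0 t 0<t t<k
                 (≤-reflexive (sym (cong ind (trans (cong emptyWindow (+-identityʳ a)) empty-a))))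
                 (≤-reflexive (sym (cong ind empty-a+t))))
            (≤-reflexive (∑-rotate k (ind ∘ emptyWindow) a emptyWindow-periodic))

  emptyWindow⇒CutFree : ∀ m → emptyWindow m ≡ true → CutFree m q
  emptyWindow⇒CutFree m empty = windowCuts≡0⇒CutFree m (≡ᵇ-true⇒≡ empty)

  CutFree⇒emptyWindow : ∀ m → CutFree m q → emptyWindow m ≡ true
  CutFree⇒emptyWindow m h = ≡⇒≡ᵇ-true (CutFree⇒windowCuts≡0 m h)

  emptyWindow⇒1≤#emptyWindows : ∀ a → emptyWindow a ≡ true → 1 ≤ #emptyWindows
  emptyWindow⇒1≤#emptyWindows a empty =
    any<⇒1≤count< k emptyWindow
      (any<-intro k emptyWindow (toℕ (node a)) (toℕ<n (node a))
        (trans (cong (_≡ᵇ 0) (windowCuts-node-≡ (toℕ (node a)) a (node-node a))) empty))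

m≤o+n⇒m-n≤o : ∀ m n o → m ≤ o + n → ℤ.+ m ℤ.- ℤ.+ n ℤ.≤ ℤ.+ o
m≤o+n⇒m-n≤o m n o m≤o+n = begin
  ℤ.+ m ℤ.- ℤ.+ n          ≤⟨ ℤP.+-monoˡ-≤ (ℤ.- ℤ.+ n) (ℤ.+≤+ m≤o+n) ⟩
  ℤ.+ (o + n) ℤ.- ℤ.+ n    ≡⟨ cong (ℤ._- ℤ.+ n) (ℤP.pos-+ o n) ⟩
  ℤ.+ o ℤ.+ ℤ.+ n ℤ.- ℤ.+ n ≡⟨ cancel (ℤ.+ o) (ℤ.+ n) ⟩
  ℤ.+ o                    ∎
  where
  open ℤP.≤-Reasoning
  cancel : ∀ a b → a ℤ.+ b ℤ.- b ≡ a
  cancel = ℤSolver.solve-∀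

m-n≡o⇒m≡o+n : ∀ m n o → ℤ.+ m ℤ.- ℤ.+ n ≡ ℤ.+ o → m ≡ o + n
m-n≡o⇒m≡o+n m n o e = ℤP.+-injective (begin
  ℤ.+ m                     ≡⟨ uncancel (ℤ.+ m) (ℤ.+ n) ⟩
  ℤ.+ m ℤ.- ℤ.+ n ℤ.+ ℤ.+ n  ≡⟨ cong (ℤ._+ ℤ.+ n) e ⟩
  ℤ.+ o ℤ.+ ℤ.+ n           ≡⟨ ℤP.pos-+ o n ⟨
  ℤ.+ (o + n)               ∎)
  where
  open ≡-Reasoning
  uncancel : ∀ a b → a ≡ a ℤ.- b ℤ.+ b
  uncancel = ℤSolver.solve-∀

m≡o+n⇒m-n≡o : ∀ m n o → m ≡ o + n → ℤ.+ m ℤ.- ℤ.+ n ≡ ℤ.+ o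
m≡o+n⇒m-n≡o m n o refl = begin
  ℤ.+ (o + n) ℤ.- ℤ.+ n      ≡⟨ cong (ℤ._- ℤ.+ n) (ℤP.pos-+ o n) ⟩
  ℤ.+ o ℤ.+ ℤ.+ n ℤ.- ℤ.+ n  ≡⟨ cancel (ℤ.+ o) (ℤ.+ n) ⟩
  ℤ.+ o                      ∎
  where
  open ≡-Reasoning
  cancel : ∀ a b → a ℤ.+ b ℤ.- b ≡ a
  cancel = ℤSolver.solve-∀

2≤⌈/⌉ : ∀ K q' → 2 * suc q' ≤ K → 2 ≤ ⌈ K / suc q' ⌉
2≤⌈/⌉ K q' 2q≤K = begin
  2                  ≡⟨ m*n/n≡m 2 (suc q') ⟨
  2 * suc q' / suc q' ≤⟨ /-monoˡ-≤ (suc q') (≤-trans 2q≤K (m≤m+n K q')) ⟩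
  (K + q') / suc q'   ∎
  where open ≤-Reasoning

pred⌈/⌉*q<K : ∀ K q' c' → ⌈ K / suc q' ⌉ ≡ suc c' → c' * suc q' < K
pred⌈/⌉*q<K K q' c' ⌈K/q⌉≡c = +-cancelʳ-≤ q' (suc (c' * suc q')) K (begin
  suc (c' * suc q') + q'   ≡⟨ expand c' q' ⟩
  suc c' * suc q'          ≡⟨ cong (_* suc q') ⌈K/q⌉≡c ⟨
  (K + q') / suc q' * suc q' ≤⟨ m/n*n≤m (K + q') (suc q') ⟩
  K + q'                   ∎)
  where
  open ≤-Reasoning
  expand : ∀ c' q' → suc (c' * suc q') + q' ≡ suc c' * suc q'
  expand = solve-∀

module CeilingBound (k q' c' C Z : ℕ) (Z≤k : Z ≤ k) (Z≤qC : Z ≤ suc q' * C) (c'q<k : c' * suc q' < k) where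

  private
    c≤k : suc c' ≤ k
    c≤k = ≤-trans (s≤s (m≤m*n c' (suc q'))) c'q<k

    expand : ∀ q' c' → q' * c' + suc c' ≡ suc (c' * suc q')
    expand = solve-∀

    few-cuts : C ≤ c' → q' * C + suc c' ≤ k
    few-cuts C≤c' = begin
      q' * C + suc c'    ≤⟨ +-monoˡ-≤ (suc c') (*-monoʳ-≤ q' C≤c') ⟩
      q' * c' + suc c'   ≡⟨ expand q' c' ⟩
      suc (c' * suc q')  ≤⟨ c'q<k ⟩
      k                  ∎
      where open ≤-Reasoning

    qC≤ : C ≤ c' → suc q' * C ≤ (k ∸ suc c') + C
    qC≤ C≤c' = ≤-trans (≤-reflexive (+-comm C (q' * C))) (+-monoˡ-≤ C (m+n≤o⇒m≤o∸n (q' * C) (few-cuts C≤c')))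

    k≤ : suc c' ≤ C → k ≤ (k ∸ suc c') + C
    k≤ c≤C = ≤-trans (≤-reflexive (sym (m∸n+n≡m c≤k))) (+-monoʳ-≤ (k ∸ suc c') c≤C)

  bound : Z ≤ (k ∸ suc c') + C
  bound with suc c' ≤? C
  ... | yes c≤C = ≤-trans Z≤k (k≤ c≤C)
  ... | no c≰C = ≤-trans Z≤qC (qC≤ (s≤s⁻¹ (≰⇒> c≰C)))

  bound-tight : 1 ≤ q' → Z ≡ (k ∸ suc c') + C →
                (C ≡ suc c' × Z ≡ k) ⊎ (C ≡ c' × Z ≡ suc q' * C × k ≡ suc q' * C + 1)
  bound-tight 1≤q' tight with suc c' ≤? C
  ... | yes c≤C = inj₁ (C≡c , Z≡k)
    where
    Z≡k : Z ≡ k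
    Z≡k = ≤-antisym Z≤k (≤-trans (k≤ c≤C) (≤-reflexive (sym tight)))
    C≡c : C ≡ suc c'
    C≡c = +-cancelˡ-≡ (k ∸ suc c') C (suc c') (trans (sym tight) (trans Z≡k (sym (m∸n+n≡m c≤k))))
  ... | no c≰C = inj₂ (C≡c' , Z≡qC , k≡qC+1)
    where
    C≤c' : C ≤ c'
    C≤c' = s≤s⁻¹ (≰⇒> c≰C)
    Z≡qC : Z ≡ suc q' * C
    Z≡qC = ≤-antisym Z≤qC (≤-trans (qC≤ C≤c') (≤-reflexive (sym tight)))
    q'C≡k∸c : q' * C ≡ k ∸ suc c'
    q'C≡k∸c = +-cancelʳ-≡ C (q' * C) (k ∸ suc c') (trans (+-comm (q' * C) C) (trans (sym Z≡qC) tight))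
    q'C+c≡k : q' * C + suc c' ≡ k
    q'C+c≡k = trans (cong (_+ suc c') q'C≡k∸c) (m∸n+n≡m c≤k)
    q'c'≤q'C : q' * c' ≤ q' * C
    q'c'≤q'C = +-cancelʳ-≤ (suc c') (q' * c') (q' * C)
                 (≤-trans (≤-reflexive (expand q' c')) (≤-trans c'q<k (≤-reflexive (sym q'C+c≡k))))
    C≡c' : C ≡ c'
    C≡c' = *-cancelˡ-≡ C c' q' {{>-nonZero 1≤q'}} (≤-antisym (*-monoʳ-≤ q' C≤c') q'c'≤q'C)
    k≡qC+1 : k ≡ suc q' * C + 1
    k≡qC+1 = trans (sym q'C+c≡k) (trans (cong (λ c → q' * C + suc c) (sym C≡c')) (regroup q' C))
      where
      regroup : ∀ q' C → q' * C + suc C ≡ suc q' * C + 1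
      regroup = solve-∀

ceiling-cuts-tight : ∀ k c C Z → c ≤ k → C ≡ c → Z ≡ k → Z ≡ (k ∸ c) + C
ceiling-cuts-tight k c C Z c≤k refl refl = sym (m∸n+n≡m c≤k)

short-cuts-tight : ∀ k q' c' C Z → C ≡ c' → Z ≡ suc q' * C → k ≡ suc q' * C + 1 → Z ≡ (k ∸ suc c') + C
short-cuts-tight k q' c' C Z refl refl refl = begin
  suc q' * C                       ≡⟨ +-comm C (q' * C) ⟩
  q' * C + C                       ≡⟨ cong (_+ C) (m+n∸n≡m (q' * C) (suc C)) ⟨
  (q' * C + suc C) ∸ suc C + C     ≡⟨ cong (λ m → m ∸ suc C + C) (regroup q' C) ⟩
  (suc q' * C + 1) ∸ suc C + C     ∎
  where
  open ≡-Reasoning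
  regroup : ∀ q' C → q' * C + suc C ≡ suc q' * C + 1
  regroup = solve-∀

module Extremal (n : ℕ) (Π : Partition (suc n)) (q : ℕ) (2≤q : 2 ≤ q) (2q≤k : 2 * q ≤ suc n) where

  open Cycle n
  open Blocks n Π
  open Windows n Π q

  private
    q+q≤k : q + q ≤ k
    q+q≤k = subst (_≤ k) (cong (q +_) (+-identityʳ q)) 2q≤k

    q≤k : q ≤ k
    q≤k = ≤-trans (m≤m+n q q) q+q≤k

    q<k : q < k
    q<k = <-≤-trans (m<m+n q (≤-trans (s≤s z≤n) 2≤q)) q+q≤k

    2+q≤k : 2 + q ≤ k
    2+q≤k = ≤-trans (+-monoˡ-≤ q 2≤q) q+q≤k

    1<k : 1 < k
    1<k = ≤-trans (s≤s (≤-trans (s≤s z≤n) 2≤q)) q<k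

    q≤k∸q : q ≤ k ∸ q
    q≤k∸q = m+n≤o⇒m≤o∸n q q+q≤k

    k∸q<k : k ∸ q < k
    k∸q<k = ∸-monoʳ-< {k} {q} {0} (≤-trans (s≤s z≤n) 2≤q) q≤k

    cycSize-at : ∀ a → cycSize Π (node (a + 0)) ≡ cycSize Π (node a)
    cycSize-at a = cong (cycSize Π ∘ node) (+-identityʳ a)

    CutFree⇒q<cycSize : ∀ a → CutFree a q → q < cycSize Π (node a)
    CutFree⇒q<cycSize a h = subst (q <_) (cycSize-at a) (run≤cycSize a q 0 h q<k z≤n)

  q≤cycSize⇒windowCuts≤1 : (∀ v → q ≤ cycSize Π v) → ∀ m → windowCuts m ≤ 1
  q≤cycSize⇒windowCuts≤1 large m with 2 ≤? windowCuts m
  ... | no ≱2 = s≤s⁻¹ (≰⇒> ≱2)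
  ... | yes ≥2 with 2≤count<⇒pair q (λ t → isCut (m + t)) ≥2
  ... | t₁ , t₂ , t₁<t₂ , t₂<q , cut₁ , cut₂ with m≤n⇒∃[o]m+o≡n t₁<t₂
  ... | o , refl = ⊥-elim (<⇒≱ (≤-<-trans (≤-trans small (s≤s (m≤n+m o t₁))) t₂<q) (large _))
    where
    small : cycSize Π (node (suc (m + t₁) + 0)) ≤ suc o
    small = cycSize≤run (m + t₁) o 0 cut₁ (trans (cong isCut (regroup m t₁ o)) cut₂) z≤n
      where
      regroup : ∀ m t o → suc (m + t) + o ≡ m + (suc t + o)
      regroup = solve-∀

  module ConditionA (a2 : ∀ i → cycSize Π i ≤ q)
                    (a3 : ∀ i j → sameBlock Π i j ≡ true → cycConn Π i j ≡ false → q < cycDist i j) where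

    private
      no-long-CutFree : ∀ (i : Fin k) d → CutFree (toℕ i) d → q ≤ d → ⊥
      no-long-CutFree i d h q≤d =
        <⇒≱ (s≤s (a2 i)) (subst (λ z → q < cycSize Π z) (node-toℕ i) (CutFree⇒q<cycSize (toℕ i) (CutFree-≤ q≤d h)))

    no-join-at-q : ∀ m → block m ≢ block (m + q)
    no-join-at-q m same with cycConn Π (node m) (node (m + q)) in conn
    ... | false = <⇒≱ (a3 (node m) (node (m + q)) (≡⇒≡ᵇ-true same) conn)
                      (subst (λ z → cycDist (node m) z ≤ q) (⊕-node m q) (cycDist-⊕ (node m) q q<k))
    ... | true with cycConn⇒Conn conn
    ... | inj₁ (d , e , h) = no-long-CutFree (node m) d h (node-≡⇒residue≤ m d q (trans (sym (⊕-node m d)) e) q<k)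
    ... | inj₂ (d , e , h) = no-long-CutFree (node (m + q)) d h (≤-trans q≤k∸q (node-≡⇒residue≤ (m + q) d (k ∸ q) back k∸q<k))
      where
      wraps : m + q + (k ∸ q) ≡ k + m
      wraps = trans (+-assoc m q (k ∸ q)) (trans (cong (m +_) (m+[n∸m]≡n q≤k)) (+-comm m k))
      back : node (m + q + d) ≡ node (m + q + (k ∸ q))
      back = trans (sym (⊕-node (m + q) d)) (trans e (trans (sym (node-k+ m)) (cong node (sym wraps))))

    #splits≡k : #splits ≡ k
    #splits≡k = trans (∑-cong k (λ m _ → split≡1 m)) (trans (∑-const k 1) (*-identityʳ k))
      where
      split≡1 : ∀ m → split m ≡ 1
      split≡1 m rewrite ≢⇒≡ᵇ-false (no-join-at-q m) = refl

  module ConditionB (u : Fin k) (u-size : cycSize Π u ≡ suc q)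
                    (others : ∀ v → cycConn Π u v ≡ false → cycSize Π v ≡ q) where

    private
      u-size′ : cycSize Π (node (toℕ u)) ≡ suc q
      u-size′ = trans (cong (cycSize Π) (node-toℕ u)) u-size

    1≤#cuts : 1 ≤ #cuts
    1≤#cuts with #cuts in no-cuts
    ... | suc _ = s≤s z≤n
    ... | zero = ⊥-elim (<⇒≱ 2+q≤k (≤-trans whole-cycle (≤-reflexive (trans (cycSize-at (toℕ u)) u-size′))))
      where
      whole-cycle : suc n ≤ cycSize Π (node (toℕ u + 0))
      whole-cycle = run≤cycSize (toℕ u) n 0 (isCut-false⇒CutFree (λ t _ → #cuts≡0⇒¬isCut no-cuts _)) ≤-refl z≤n

    q≤cycSize : ∀ v → q ≤ cycSize Π v
    q≤cycSize v with cycConn Π u v in conn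
    ... | false = ≤-reflexive (sym (others v conn))
    ... | true = ≤-trans (n≤1+n q) (≤-reflexive (sym (trans (Conn⇒cycSize-≡ 1≤#cuts u v (cycConn⇒Conn conn)) u-size)))

    #splits≡q*#cuts : #splits ≡ q * #cuts
    #splits≡q*#cuts =
      trans (∑-cong k (λ m _ → windowCuts≤1⇒split≡windowCuts m (q≤cycSize⇒windowCuts≤1 q≤cycSize m)))
            ∑windowCuts≡q*#cuts

    private
      runU : Run (toℕ u)
      runU = run (toℕ u) 1≤#cuts

      open Run runU

      d≡q : d ≡ q
      d≡q = suc-injective (trans (sym (cycSize-run-start runU)) u-size′)

      emptyWindow⇒at-u : ∀ t → emptyWindow t ≡ true → node t ≡ node (suc α)
      emptyWindow⇒at-u t empty with cycConn Π u (node t) in conn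
      ... | false = ⊥-elim (<⇒≱ (CutFree⇒q<cycSize t (emptyWindow⇒CutFree t empty)) (≤-reflexive (others (node t) conn)))
      ... | true with cuts-enclose α d e (node t) cut-start cut-end e≤d
                        (subst (λ z → Conn z (node t)) (sym (trans pos (node-toℕ u))) (cycConn⇒Conn conn))
      ... | zero , _ , at = sym (trans (cong node (sym (+-identityʳ (suc α)))) at)
      ... | suc s , s<d , at = contradictionᵇ cut-end (trans (cong isCut end) (CutFree⇒isCut-false window (q ∸ suc s) inside))
        where
        s<q : suc s ≤ q
        s<q = subst (suc s ≤_) d≡q s<d
        window : CutFree (suc α + suc s) q
        window = CutFree-node-≡ {t} {suc α + suc s} {q} (sym at) (emptyWindow⇒CutFree t empty)
        inside : q ∸ suc s < q
        inside = ∸-monoʳ-< {q} {suc s} {0} (s≤s z≤n) s<q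
        end : suc α + d ≡ suc α + suc s + (q ∸ suc s)
        end = trans (cong (suc α +_) (trans d≡q (sym (m+[n∸m]≡n s<q)))) (sym (+-assoc (suc α) (suc s) (q ∸ suc s)))

    #emptyWindows≡1 : #emptyWindows ≡ 1
    #emptyWindows≡1 = ≤-antisym at-most-one
      (emptyWindow⇒1≤#emptyWindows (suc α) (CutFree⇒emptyWindow (suc α) (subst (CutFree (suc α)) d≡q free)))
      where
      at-most-one : #emptyWindows ≤ 1
      at-most-one with 2 ≤? #emptyWindows
      ... | no ≱2 = s≤s⁻¹ (≰⇒> ≱2)
      ... | yes ≥2 with 2≤count<⇒pair k emptyWindow ≥2
      ... | t₁ , t₂ , t₁<t₂ , t₂<k , empty₁ , empty₂ =
        ⊥-elim (<⇒≢ t₁<t₂ (toℕ-injective′ (trans (emptyWindow⇒at-u t₁ empty₁) (sym (emptyWindow⇒at-u t₂ empty₂)))))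
        where
        toℕ-injective′ : node t₁ ≡ node t₂ → t₁ ≡ t₂
        toℕ-injective′ e = trans (sym (toℕ-node-< t₁ (<-trans t₁<t₂ t₂<k))) (trans (cong toℕ e) (toℕ-node-< t₂ t₂<k))

    k≡q*#cuts+1 : k ≡ q * #cuts + 1
    k≡q*#cuts+1 = trans (sym (windowCuts≤1⇒q*#cuts+#emptyWindows≡k (q≤cycSize⇒windowCuts≤1 q≤cycSize)))
                        (cong (q * #cuts +_) #emptyWindows≡1)

  module EqualityB (1≤#cuts : 1 ≤ #cuts) (splits≡ : #splits ≡ q * #cuts) (k≡ : k ≡ q * #cuts + 1) where

    private
      windowCuts≤1 : ∀ m → windowCuts m ≤ 1
      windowCuts≤1 m = subst (_≤ 1) (trans split≡windowCuts (windowCuts-node-≡ (toℕ (node m)) m (node-node m))) (ind≤1 _)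
        where
        split≡windowCuts : split (toℕ (node m)) ≡ windowCuts (toℕ (node m))
        split≡windowCuts = ∑-≡⇒pointwise k split windowCuts (λ m _ → split≤windowCuts m)
                             (trans splits≡ (sym ∑windowCuts≡q*#cuts)) (toℕ (node m)) (toℕ<n (node m))

      #emptyWindows≡1 : #emptyWindows ≡ 1
      #emptyWindows≡1 = +-cancelˡ-≡ (q * #cuts) #emptyWindows 1
                          (trans (windowCuts≤1⇒q*#cuts+#emptyWindows≡k windowCuts≤1) k≡)

      unique-empty : ∀ a t → 0 < t → t < k → emptyWindow a ≡ true → emptyWindow (a + t) ≡ true → ⊥
      unique-empty a t 0<t t<k empty-a empty-a+t =
        <⇒≱ (s≤s (s≤s z≤n)) (subst (2 ≤_) #emptyWindows≡1 (two-emptyWindows a t 0<t t<k empty-a empty-a+t))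

    empty : Σ ℕ λ m → m < k × emptyWindow m ≡ true
    empty = any<-elim k emptyWindow (1≤count<⇒any< k emptyWindow (≤-reflexive (sym #emptyWindows≡1)))

    module _ (m : ℕ) (empty-m : emptyWindow m ≡ true) where

      cycSize≡suc-q : cycSize Π (node m) ≡ suc q
      cycSize≡suc-q = trans (cycSize-run-start r) (cong suc (≤-antisym d≤q q≤d))
        where
        r = run m 1≤#cuts
        open Run r
        q≤d : q ≤ d
        q≤d = s≤s⁻¹ (≤-trans (CutFree⇒q<cycSize m (emptyWindow⇒CutFree m empty-m)) (≤-reflexive (cycSize-run-start r)))
        d≤q : d ≤ q
        d≤q with suc q ≤? d
        ... | no d≰q = s≤s⁻¹ (≰⇒> d≰q)
        ... | yes q<d = ⊥-elim (unique-empty (suc α) 1 (s≤s z≤n) 1<k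
                            (CutFree⇒emptyWindow (suc α) (CutFree-≤ (≤-trans (n≤1+n q) q<d) free))
                            (CutFree⇒emptyWindow (suc α + 1) (CutFree-drop 1 q (CutFree-≤ q<d free))))

      others≡q : ∀ v → cycConn Π (node m) v ≡ false → cycSize Π v ≡ q
      others≡q v apart = trans (trans (cong (cycSize Π) (sym (node-toℕ v))) (cycSize-run-start r)) (≤-antisym d<q q≤1+d)
        where
        r = run (toℕ v) 1≤#cuts
        open Run r
        q≤1+d : q ≤ suc d
        q≤1+d with q ≤? suc d
        ... | yes q≤ = q≤
        ... | no q≰ = ⊥-elim (<⇒≱ (s≤s (s≤s z≤n)) (≤-trans two-cuts (windowCuts≤1 α)))
          where
          two-cuts : 2 ≤ windowCuts α
          two-cuts = 2≤∑ q (λ t → cut (α + t)) 0 (suc d) (s≤s z≤n) (≰⇒> q≰)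
                       (≤-reflexive (sym (cong ind (trans (cong isCut (+-identityʳ α)) cut-start))))
                       (≤-reflexive (sym (cong ind (trans (cong isCut (+-suc α d)) cut-end))))
        d<q : suc d ≤ q
        d<q with q ≤? d
        ... | no q≰d = ≰⇒> q≰d
        ... | yes q≤d with node-offset m (node (suc α))
        ... | zero , _ , at =
          contradictionᵇ (Conn⇒cycConn (subst₂ Conn start (trans pos (node-toℕ v)) (CutFree⇒Conn free 0 e z≤n e≤d))) apart
          where
          start : node (suc α + 0) ≡ node m
          start = trans (cong node (+-identityʳ (suc α))) (trans (sym at) (cong node (+-identityʳ m)))
        ... | suc t , t<k , at = ⊥-elim (unique-empty m (suc t) (s≤s z≤n) t<k empty-m
                                   (trans (cong (_≡ᵇ 0) (windowCuts-node-≡ (m + suc t) (suc α) at))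
                                          (CutFree⇒emptyWindow (suc α) (CutFree-≤ q≤d free))))

  module EqualityA (c' : ℕ) (1≤c' : 1 ≤ c') (c'q<k : c' * q < k)
                   (#cuts≡ : #cuts ≡ suc c') (#splits≡k : #splits ≡ k) where

    private
      1≤#cuts : 1 ≤ #cuts
      1≤#cuts = subst (1 ≤_) (sym #cuts≡) (s≤s z≤n)

    no-join-at-q : ∀ m → block m ≢ block (m + q)
    no-join-at-q m same = 0≢1+n (trans (sym (block-≡⇒split≡0 m′ same′)) split≡1)
      where
      m′ = toℕ (node m)
      split≡1 : split m′ ≡ 1
      split≡1 = ∑-≡⇒pointwise k split (λ _ → 1) (λ m _ → ind≤1 _)
                  (trans #splits≡k (sym (trans (∑-const k 1) (*-identityʳ k)))) m′ (toℕ<n (node m))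
      same′ : block m′ ≡ block (m′ + q)
      same′ = trans (trans (cong block (sym (+-identityʳ m′))) (block-reduce m 0))
                    (trans (cong block (+-identityʳ m)) (trans same (sym (block-reduce m q))))

    1≤windowCuts : ∀ m → 1 ≤ windowCuts m
    1≤windowCuts m with windowCuts m in none
    ... | suc _ = s≤s z≤n
    ... | zero = ⊥-elim (no-join-at-q m (CutFree⇒block-≡ (windowCuts≡0⇒CutFree m none) q ≤-refl))

    cycSize≤q : ∀ i → cycSize Π i ≤ q
    cycSize≤q i = subst (_≤ q) (sym (trans (cong (cycSize Π) (sym (node-toℕ i))) (cycSize-run-start r))) d<q
      where
      r = run (toℕ i) 1≤#cuts
      open Run r
      d<q : suc d ≤ q
      d<q with q ≤? d
      ... | no q≰d = ≰⇒> q≰d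
      ... | yes q≤d with subst (1 ≤_) (CutFree⇒windowCuts≡0 (suc α) (CutFree-≤ q≤d free)) (1≤windowCuts (suc α))
      ... | ()

    r≤cuts-in-r-windows : ∀ r x → r ≤ ∑ (r * q) (λ t → cut (x + t))
    r≤cuts-in-r-windows zero x = z≤n
    r≤cuts-in-r-windows (suc r) x = subst (suc r ≤_) (sym (∑-split q (r * q) (λ t → cut (x + t))))
      (+-mono-≤ (1≤windowCuts x)
                (subst (r ≤_) (∑-cong (r * q) (λ t _ → cong cut (+-assoc x q t))) (r≤cuts-in-r-windows r (x + q))))

    -- A node i whose block reappears at i ⊕ e' (e' ≤ q) outside its cyclic component: the run of i
    -- ends with a cut before e', the last cut before e' starts a stretch of i's block, and the first
    -- cut after e' ends it.  If the stretch reaches q beyond the start of the run, some m and m + q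
    -- share a block; otherwise a window of length at most q holds three cuts, and since every
    -- window of length q holds one, there are more than ⌈k/q⌉ cuts in total.
    module Collision (i : Fin k) (e' : ℕ) (e'≤q : e' ≤ q) (same : Π i ≡ Π (i ⊕ e'))
                     (apart : ¬ Conn i (i ⊕ e')) where

      private
        r = run (toℕ i) 1≤#cuts
      open Run r

      private
        P g : ℕ
        P = suc α + e
        g = d ∸ e

        e+g≡d : e + g ≡ d
        e+g≡d = m+[n∸m]≡n e≤d

        P-node : node P ≡ i
        P-node = trans pos (node-toℕ i)

        run-rest : CutFree P g
        run-rest = CutFree-drop e g (subst (CutFree (suc α)) (sym e+g≡d) free)

        cut-g : isCut (P + g) ≡ true
        cut-g = trans (cong isCut (trans (+-assoc (suc α) e g) (cong (suc α +_) e+g≡d))) cut-end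

        P-same : block P ≡ block (P + e')
        P-same = trans (cong Π P-node) (trans same (cong Π (trans (cong (_⊕ e') (sym P-node)) (⊕-node P e'))))

        g<e' : g < e'
        g<e' with e' ≤? g
        ... | no e'≰g = ≰⇒> e'≰g
        ... | yes e'≤g = ⊥-elim (apart (inj₁ (e' , refl ,
                           CutFree-node-≡ {P} {toℕ i} {e'} (trans P-node (sym (node-toℕ i))) (CutFree-≤ e'≤g run-rest))))

      module LastCut (ul : ℕ) (ul<e' : ul < e') (cut-ul : isCut (P + ul) ≡ true)
                     (after-ul : ∀ u → ul < u → u < e' → isCut (P + u) ≡ false) where

        private
          tail-free : ∀ x → ul ≤ x → x < e' → CutFree (P + suc x) (e' ∸ suc x)
          tail-free x ul≤x x<e' = isCut-false⇒CutFree λ s s< →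
            trans (cong isCut (+-assoc P (suc x) s))
                  (after-ul (suc x + s) (s≤s (≤-trans ul≤x (m≤m+n x s))) (subst (suc x + s <_) (m+[n∸m]≡n x<e') (+-monoʳ-< (suc x) s<)))

          tail-block : ∀ x → ul ≤ x → x < e' → block (P + suc x) ≡ block (P + e')
          tail-block x ul≤x x<e' =
            trans (CutFree⇒block-≡ (tail-free x ul≤x x<e') (e' ∸ suc x) ≤-refl)
                  (cong block (trans (+-assoc P (suc x) (e' ∸ suc x)) (cong (P +_) (m+[n∸m]≡n x<e'))))

          g≤ul : g ≤ ul
          g≤ul with ul <? g
          ... | no ul≮g = ≮⇒≥ ul≮g
          ... | yes ul<g = contradictionᵇ cut-g (after-ul g ul<g g<e')

          g<ul : g < ul
          g<ul with m≤n⇒m<n∨m≡n g≤ul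
          ... | inj₁ g<ul = g<ul
          ... | inj₂ refl = ⊥-elim (isCut-true⇒≢ cut-g
                  (trans (sym (CutFree⇒block-≡ run-rest g ≤-refl))
                         (trans P-same (trans (sym (tail-block g ≤-refl g<e')) (cong block (+-suc P g))))))

        module NextCut (v : ℕ) (cut-v : isCut (P + e' + v) ≡ true)
                       (before-v : ∀ u → u < v → isCut (P + e' + u) ≡ false) where

          private
            L : ℕ
            L = (e' ∸ suc ul) + v

            stretch-free : CutFree (P + suc ul) L
            stretch-free = CutFree-++ (e' ∸ suc ul) v (tail-free ul ≤-refl ul<e')
                             (subst (λ z → CutFree z v) (sym stretch-joins) (isCut-false⇒CutFree before-v))
              where
              stretch-joins : P + suc ul + (e' ∸ suc ul) ≡ P + e'
              stretch-joins = trans (+-assoc P (suc ul) (e' ∸ suc ul)) (cong (P +_) (m+[n∸m]≡n ul<e'))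

            stretch-block : block (P + e') ≡ block (P + suc ul)
            stretch-block = sym (tail-block ul ≤-refl ul<e')

            wide⇒⊥ : q ≤ e + e' + v → ⊥
            wide⇒⊥ wide = no-join-at-q (suc α + μ) (trans before-P (trans P-same (trans stretch-block (sym after-ul+q))))
              where
              a = e + suc ul
              μ = a ∸ q
              μ≤e : μ ≤ e
              μ≤e = m≤n+o⇒m∸n≤o a q (subst (a ≤_) (+-comm e q) (+-monoʳ-≤ e (≤-trans ul<e' e'≤q)))
              before-P : block (suc α + μ) ≡ block P
              before-P = trans (sym (CutFree⇒block-≡ free μ (≤-trans μ≤e e≤d))) (CutFree⇒block-≡ free e e≤d)
              bounds : a ≤ μ + q × μ + q ≤ e + e' + v
              bounds with q ≤? a
              ... | yes q≤a = ≤-reflexive (sym (m∸n+n≡m q≤a)) ,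
                              ≤-trans (≤-reflexive (m∸n+n≡m q≤a)) (≤-trans (+-monoʳ-≤ e ul<e') (m≤m+n (e + e') v))
              ... | no q≰a = subst (a ≤_) (cong (_+ q) (sym μ≡0)) (<⇒≤ (≰⇒> q≰a)) ,
                             subst (_≤ e + e' + v) (cong (_+ q) (sym μ≡0)) wide
                where
                μ≡0 : μ ≡ 0
                μ≡0 = m≤n⇒m∸n≡0 (<⇒≤ (≰⇒> q≰a))
              w = (μ + q) ∸ a
              a+w≡μ+q : a + w ≡ μ + q
              a+w≡μ+q = m+[n∸m]≡n (proj₁ bounds)
              w≤L : w ≤ L
              w≤L = +-cancelˡ-≤ a w L (≤-trans (≤-reflexive a+w≡μ+q) (≤-trans (proj₂ bounds) (≤-reflexive split-e')))
                where
                regroup : ∀ e s r v → e + (s + r) + v ≡ e + s + (r + v)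
                regroup = solve-∀
                split-e' : e + e' + v ≡ a + L
                split-e' = trans (cong (λ z → e + z + v) (sym (m+[n∸m]≡n ul<e'))) (regroup e (suc ul) (e' ∸ suc ul) v)
              after-ul+q : block (suc α + μ + q) ≡ block (P + suc ul)
              after-ul+q = trans (cong block position) (sym (CutFree⇒block-≡ stretch-free w w≤L))
                where
                regroup : ∀ x e s w → x + (e + s + w) ≡ x + e + s + w
                regroup = solve-∀
                position : suc α + μ + q ≡ P + suc ul + w
                position = trans (+-assoc (suc α) μ q) (trans (cong (suc α +_) (sym a+w≡μ+q)) (regroup (suc α) e (suc ul) w))

            narrow⇒⊥ : e + e' + v < q → ⊥
            narrow⇒⊥ narrow = <⇒≱ too-few (subst (3 + (c' ∸ 1) ≤_) (sym (trans (sym (#cuts-rotate (suc α))) split-cycle))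
                                                   (+-mono-≤ three-in-window rest))
              where
              too-few : #cuts < 3 + (c' ∸ 1)
              too-few = subst₂ _<_ (sym #cuts≡) (cong (λ z → suc (suc z)) (sym (m+[n∸m]≡n 1≤c'))) (n<1+n (suc c'))
              δ = suc (e + e' + v)
              F : ℕ → ℕ
              F t = cut (suc α + t)
              split-cycle : ∑ k F ≡ ∑ δ F + ∑ (k ∸ δ) (λ t → F (δ + t))
              split-cycle = trans (cong (λ z → ∑ z F) (sym (m+[n∸m]≡n (≤-trans narrow q≤k)))) (∑-split δ (k ∸ δ) F)
              three-in-window : 3 ≤ ∑ δ F
              three-in-window = 3≤∑ δ F d (e + ul) (e + e' + v)
                                  (subst (_< e + ul) e+g≡d (+-monoʳ-< e g<ul))
                                  (≤-trans (+-monoʳ-< e ul<e') (m≤m+n (e + e') v))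
                                  (n<1+n _)
                                  (≤-reflexive (sym (cong ind cut-end)))
                                  (≤-reflexive (sym (cong ind (trans (cong isCut (sym (+-assoc (suc α) e ul))) cut-ul))))
                                  (≤-reflexive (sym (cong ind (trans (cong isCut (regroup (suc α) e e' v)) cut-v))))
                where
                regroup : ∀ x e e' v → x + (e + e' + v) ≡ x + e + e' + v
                regroup = solve-∀
              fits : (c' ∸ 1) * q ≤ k ∸ δ
              fits = m+n≤o⇒m≤o∸n ((c' ∸ 1) * q)
                       (≤-trans (+-monoʳ-≤ ((c' ∸ 1) * q) narrow)
                         (≤-trans (≤-reflexive (trans (+-comm ((c' ∸ 1) * q) q) (cong (_* q) (m+[n∸m]≡n 1≤c'))))
                                  (≤-trans (n≤1+n _) c'q<k)))
              rest : c' ∸ 1 ≤ ∑ (k ∸ δ) (λ t → F (δ + t))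
              rest = ≤-trans (r≤cuts-in-r-windows (c' ∸ 1) (suc α + δ))
                       (≤-trans (≤-reflexive (∑-cong ((c' ∸ 1) * q) (λ t _ → cong cut (+-assoc (suc α) δ t))))
                                (∑-prefix-≤ ((c' ∸ 1) * q) (k ∸ δ) (λ t → F (δ + t)) fits))

          impossible : ⊥
          impossible with q ≤? e + e' + v
          ... | yes wide = wide⇒⊥ wide
          ... | no narrow = narrow⇒⊥ (≰⇒> narrow)

        impossible : ⊥
        impossible with first< q (λ t → isCut (P + e' + t)) (1≤count<⇒any< q (λ t → isCut (P + e' + t)) (1≤windowCuts (P + e')))
        ... | v , _ , cut-v , before-v = NextCut.impossible v cut-v before-v

      impossible : ⊥
      impossible with last< e' (λ u → isCut (P + u)) (any<-intro e' (λ u → isCut (P + u)) g g<e' cut-g)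
      ... | ul , ul<e' , cut-ul , after-ul = LastCut.impossible ul ul<e' cut-ul after-ul

    separated : ∀ i j → sameBlock Π i j ≡ true → cycConn Π i j ≡ false → q < cycDist i j
    separated i j same apart with q <? cycDist i j
    ... | yes q<dist = q<dist
    ... | no q≮dist with ⊓-sel (offset j i) (offset i j)
    ... | inj₁ dist≡ji = ⊥-elim (Collision.impossible j (offset j i) (subst (_≤ q) dist≡ji (≮⇒≥ q≮dist))
                           (trans (sym (≡ᵇ-true⇒≡ same)) (cong Π (sym (⊕-offset j i))))
                           (λ c → contradictionᵇ (Conn⇒cycConn (Conn-sym (subst (Conn j) (⊕-offset j i) c))) apart))
    ... | inj₂ dist≡ij = ⊥-elim (Collision.impossible i (offset i j) (subst (_≤ q) dist≡ij (≮⇒≥ q≮dist))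
                           (trans (≡ᵇ-true⇒≡ same) (cong Π (sym (⊕-offset i j))))
                           (λ c → contradictionᵇ (Conn⇒cycConn (subst (Conn i) (⊕-offset i j) c)) apart))

module Theorem (n q' : ℕ) (Π : Partition (suc n)) (2≤q : 2 ≤ suc q') (2q≤k : 2 * suc q' ≤ suc n) where

  open Cycle n
  open Blocks n Π
  open Windows n Π (suc q')
  open Extremal n Π (suc q') 2≤q 2q≤k

  private
    q = suc q'

    2≤⌈k/q⌉ : 2 ≤ ⌈ k / q ⌉
    2≤⌈k/q⌉ = 2≤⌈/⌉ k q' 2q≤k

    c' : ℕ
    c' = ⌈ k / q ⌉ ∸ 1

    ⌈k/q⌉≡ : ⌈ k / q ⌉ ≡ suc c'
    ⌈k/q⌉≡ = sym (m+[n∸m]≡n (≤-trans (s≤s z≤n) 2≤⌈k/q⌉))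

    1≤c' : 1 ≤ c'
    1≤c' = ∸-monoˡ-≤ 1 2≤⌈k/q⌉

    1≤q' : 1 ≤ q'
    1≤q' = s≤s⁻¹ 2≤q

    c'q<k : c' * q < k
    c'q<k = pred⌈/⌉*q<K k q' c' ⌈k/q⌉≡

    open CeilingBound k q' c' #cuts #splits #splits≤k #splits≤q*#cuts c'q<k

    Tight : Set
    Tight = #splits ≡ (k ∸ suc c') + #cuts

    bound-rhs : ℤ.+ (k ∸ suc c') ≡ ℤ.+ (k ∸ ⌈ k / q ⌉)
    bound-rhs = cong (λ c → ℤ.+ (k ∸ c)) (sym ⌈k/q⌉≡)

  lhs≤ : lhs Π q ℤ.≤ ℤ.+ (k ∸ ⌈ k / q ⌉)
  lhs≤ = subst₂ ℤ._≤_ (sym lhs≡#splits-#cuts) bound-rhs (m≤o+n⇒m-n≤o #splits #cuts (k ∸ suc c') bound)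

  lhs≡⇔Tight : (lhs Π q ≡ ℤ.+ (k ∸ ⌈ k / q ⌉)) ⇔ Tight
  lhs≡⇔Tight = mk⇔
    (λ e → m-n≡o⇒m≡o+n #splits #cuts (k ∸ suc c') (trans (sym lhs≡#splits-#cuts) (trans e (sym bound-rhs))))
    (λ t → trans lhs≡#splits-#cuts (trans (m≡o+n⇒m-n≡o #splits #cuts (k ∸ suc c') t) bound-rhs))

  Tight⇒conditions : Tight → condA Π q ⊎ condB Π q
  Tight⇒conditions t with bound-tight 1≤q' t
  ... | inj₁ (#cuts≡ , #splits≡) = inj₁ (numCyc≡ , cycSize≤q , separated)
    where
    open EqualityA c' 1≤c' c'q<k #cuts≡ #splits≡
    numCyc≡ : numCyc Π ≡ ⌈ k / q ⌉
    numCyc≡ = trans (numCyc≡#cuts (subst (1 ≤_) (sym #cuts≡) (s≤s z≤n))) (trans #cuts≡ (sym ⌈k/q⌉≡))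
  ... | inj₂ (#cuts≡ , #splits≡ , k≡) = inj₂ (numCyc≡ , node m , cycSize≡suc-q m empty-m , others≡q m empty-m)
    where
    1≤#cuts : 1 ≤ #cuts
    1≤#cuts = subst (1 ≤_) (sym #cuts≡) 1≤c'
    open EqualityB 1≤#cuts #splits≡ k≡
    m = proj₁ empty
    empty-m = proj₂ (proj₂ empty)
    numCyc≡ : numCyc Π ≡ ⌈ k / q ⌉ ∸ 1
    numCyc≡ = trans (numCyc≡#cuts 1≤#cuts) (trans #cuts≡ (cong (_∸ 1) (sym ⌈k/q⌉≡)))

  conditions⇒Tight : condA Π q ⊎ condB Π q → Tight
  conditions⇒Tight (inj₁ (a1 , a2 , a3)) =
    ceiling-cuts-tight k (suc c') #cuts #splits (≤-trans (s≤s (m≤m*n c' q)) c'q<k) #cuts≡ (ConditionA.#splits≡k a2 a3)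
    where
    #cuts≡ : #cuts ≡ suc c'
    #cuts≡ with #cuts in C
    ... | zero = ⊥-elim (<⇒≢ (s≤s 1≤c') (trans (sym (numCyc≡1 C)) (trans a1 ⌈k/q⌉≡)))
    ... | suc _ = trans (sym (numCyc≡#cuts′)) (trans a1 ⌈k/q⌉≡)
      where
      numCyc≡#cuts′ : numCyc Π ≡ suc _
      numCyc≡#cuts′ = trans (numCyc≡#cuts (subst (1 ≤_) (sym C) (s≤s z≤n))) C
  conditions⇒Tight (inj₂ (b1 , u , u-size , others)) =
    short-cuts-tight k q' c' #cuts #splits #cuts≡ #splits≡q*#cuts k≡q*#cuts+1
    where
    open ConditionB u u-size others
    #cuts≡ : #cuts ≡ c'
    #cuts≡ = trans (sym (numCyc≡#cuts 1≤#cuts)) (trans b1 (cong (_∸ 1) ⌈k/q⌉≡))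

lemma3 : (q k : ℕ) → 2 ≤ q → 2 * q ≤ k → (Π : Partition k) →
    (lhs Π q ℤ.≤ ℤ.+ (k ∸ ⌈ k / q ⌉))
    × ((lhs Π q ≡ ℤ.+ (k ∸ ⌈ k / q ⌉)) ⇔ (condA Π q ⊎ condB Π q))
lemma3 (suc (suc q'')) zero _ () Π
lemma3 (suc q') (suc n) 2≤q 2q≤k Π =
  lhs≤ , ⇔-trans lhs≡⇔Tight (mk⇔ Tight⇒conditions conditions⇒Tight)
  where open Theorem n q' Π 2≤q 2q≤k
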